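{- Let $w\in S_n$, $C$ a commutation class of reduced words for $w$, and $\rho=\mathbb 1_{\operatorname{Pre}(C)}$ the uniform vote tally on $\operatorname{Pre}(C)$. Then for every $ab\in\operatorname{Inv}(w)=P_C$, $$\Sigma_\rho(ab)=|\{I\in J(P_C):ab\in I\}|=|J((P_C)_{\not\le ab})|,$$ where $(P_C)_{\not\le ab}=\{cd\in P_C:cd\not\le_{P_C}ab\}$ with the induced order.
   Context: For $w=(w_1,\dots,w_n)\in S_n$, $<_w$ denotes the linear order $w_1<_w\cdots<_w w_n$ on $[n]$, and $\operatorname{Inv}(w)=\{(a,b):1\le a<b\le n,\ b<_w a\}$, pairs written $ab$. Let $s_i$ be the adjacent transposition of $i,i+1$; $ws_i$ is obtained from $w$ by swapping the entries in positions $i,i+1$. A reduced word for $w$ is $(i_1,\dots,i_\ell)$ with $w=s_{i_1}\cdots s_{i_\ell}$, $\ell=|\operatorname{Inv}(w)|$. The commutation class $C(\mathbf i)$ is the set of words obtained from $\mathbf i$ by repeatedly swapping adjacent entries differing by at least $2$. $\operatorname{Pre}(C)$ is the set of all $s_{i'_1}\cdots s_{i'_m}$ ($0\le m\le\ell$) with $(i'_1,\dots,i'_m)$ a prefix of a word in $C$. The heap poset $P_C$ on $\operatorname{Inv}(w)$: fix $\mathbf i\in C$, let $x_j$ be the unique element of $\operatorname{Inv}(s_{i_1}\cdots s_{i_j})\setminus\operatorname{Inv}(s_{i_1}\cdots s_{i_{j-1}})$; $P_C$ is the transitive closure of the relations $x_j<x_k$ for $j<k$ with $|i_j-i_k|\le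 1$. $J(P)$ is the set of order ideals of a poset $P$. The uniform vote tally $\mathbb 1_{\operatorname{Pre}(C)}:S_n\to\mathbb N$ is $1$ on $\operatorname{Pre}(C)$ and $0$ elsewhere. The $\rho$-tally function is $\Sigma_\rho(ab)=\sum_{w'\in\operatorname{Pre}(C):\,ab\in\operatorname{Inv}(w')}\rho(w')$. -}

module Defs where

open import Data.Nat using (ℕ; zero; suc; _<_; _≤_; _∸_; ∣_-_∣)
open import Data.Product using (Σ; ∃; ∃-syntax; _×_; _,_)
open import Data.Sum using (_⊎_)
open import Data.List using (List; []; _∷_; _++_; foldl; applyUpTo; take; length; map)
open import Data.Nat.ListAction using (sum)
open import Data.List.Relation.Unary.All using (All)
open import Data.List.Relation.Unary.Unique.Propositional using (Unique)
open import Data.List.Relation.Unary.Linked using (Linked)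
open import Data.List.Relation.Binary.Permutation.Propositional using (_↭_)
open import Data.List.Membership.Propositional using (_∈_)
open import Data.Maybe using (Maybe; just; nothing)
open import Relation.Binary.PropositionalEquality using (_≡_)
open import Relation.Binary.Construct.Closure.ReflexiveTransitive using (Star)
open import Relation.Nullary using (¬_)
open import Function.Bundles using (_⇔_)

idPerm : ℕ → List ℕ
idPerm n = applyUpTo suc n

IsPerm : ℕ → List ℕ → Set
IsPerm n w = w ↭ idPerm n

-- w ↦ w s_i : swap the entries in (1-indexed) positions i and i+1
swapAt : ℕ → List ℕ → List ℕ
swapAt (suc zero)    (x ∷ y ∷ xs) = y ∷ x ∷ xs
swapAt (suc (suc i)) (x ∷ xs)     = x ∷ swapAt (suc i) xs
swapAt _             xs           = xs

evalWord : ℕ → List ℕ → List ℕ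
evalWord n ws = foldl (λ u i → swapAt i u) (idPerm n) ws

ValidLetter : ℕ → ℕ → Set
ValidLetter n i = 1 ≤ i × suc i ≤ n

Pair : Set
Pair = ℕ × ℕ

Before : List ℕ → ℕ → ℕ → Set
Before w x y = Σ (List ℕ) λ xs → Σ (List ℕ) λ ys → (w ≡ xs ++ x ∷ ys) × (y ∈ ys)

InInv : List ℕ → Pair → Set
InInv w (a , b) = (a < b) × Before w b a

HasSize : {A : Set} → (A → Set) → ℕ → Set
HasSize {A} P k = Σ (List A) λ L → Unique L × (∀ x → (x ∈ L) ⇔ P x) × (length L ≡ k)

TallyIs : {A : Set} → (A → Set) → (A → ℕ) → ℕ → Set
TallyIs {A} P ρ k = Σ (List A) λ L → Unique L × (∀ x → (x ∈ L) ⇔ P x) × (sum (map ρ L) ≡ k)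

IsIndicator : {A : Set} → (A → ℕ) → (A → Set) → Set
IsIndicator {A} ρ S = ∀ (x : A) → (S x → ρ x ≡ 1) × (¬ S x → ρ x ≡ 0)

IsReducedWord : ℕ → List ℕ → List ℕ → Set
IsReducedWord n w ws = All (ValidLetter n) ws × (evalWord n ws ≡ w) × HasSize (InInv w) (length ws)

data CommStep : List ℕ → List ℕ → Set where
  comm : ∀ (xs ys : List ℕ) (i j : ℕ) → 2 ≤ ∣ i - j ∣ →
         CommStep (xs ++ i ∷ j ∷ ys) (xs ++ j ∷ i ∷ ys)

InCommClass : List ℕ → List ℕ → Set
InCommClass i j = Star CommStep i j

InPre : ℕ → List ℕ → List ℕ → Set
InPre n i u = Σ (List ℕ) λ j → InCommClass i j × Σ ℕ λ m → (m ≤ length i) × (evalWord n (take m j) ≡ u)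

-- 0-indexed lookup
_!_ : List ℕ → ℕ → Maybe ℕ
[] ! _ = nothing
(x ∷ xs) ! zero = just x
(x ∷ xs) ! suc k = xs ! k

-- x is x_{j+1}: the unique element of Inv(s_{i_1}⋯s_{i_{j+1}}) ∖ Inv(s_{i_1}⋯s_{i_j})
IsX : ℕ → List ℕ → ℕ → Pair → Set
IsX n i j x = InInv (evalWord n (take (suc j) i)) x × ¬ InInv (evalWord n (take j i)) x

HeapCover : ℕ → List ℕ → Pair → Pair → Set
HeapCover n i x y = Σ ℕ λ j → Σ ℕ λ k → Σ ℕ λ p → Σ ℕ λ q →
  (j < k) × (i ! j ≡ just p) × (i ! k ≡ just q) × (∣ p - q ∣ ≤ 1) × IsX n i j x × IsX n i k y

HeapLe : ℕ → List ℕ → Pair → Pair → Set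
HeapLe n i = Star (HeapCover n i)

-- Order ideals; a finite set of pairs is encoded canonically as a
-- strictly lexicographically increasing list

_<ₗ_ : Pair → Pair → Set
(a , b) <ₗ (c , d) = (a < c) ⊎ ((a ≡ c) × (b < d))

IsIdeal : (Pair → Set) → (Pair → Pair → Set) → List Pair → Set
IsIdeal S _≤P_ I = Linked _<ₗ_ I × (∀ x → x ∈ I → S x) ×
  (∀ x y → y ∈ I → S x → x ≤P y → x ∈ I)

-- Let x_1, …, x_ℓ be the inversions added by the successive letters of i.  A word j of the
-- commutation class C reorders the letters of i without changing the relative order of two
-- letters that do not commute, so it adds the same inversions in an order compatible with P_C;
-- hence the inversion set of every element of Pre(C) is an order ideal of P_C.  Conversely an
-- order ideal I is the inversion set of a prefix of some j ∈ C: repeatedly swap a letter whose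
-- inversion lies outside I with the next letter, whose inversion lies in I.  These two letters
-- commute because I is a down-set, and each swap lowers the sum of the positions of the letters
-- with inversions in I.  As a permutation is determined by its inversion set, u ↦ Inv(u) is a
-- bijection from Pre(C) onto J(P_C) under which ab ∈ Inv(u) becomes ab ∈ I, and since ρ is the
-- indicator of Pre(C), Σ_ρ(ab) counts these u.  Finally I ↦ I ∖ ↓ab maps the ideals containing
-- ab bijectively onto J((P_C)_{≰ab}), with inverse J ↦ J ∪ ↓ab.

module Submission where

open import Defs
open import Data.Nat using (ℕ; zero; suc; _+_; _<_; _≤_; _∸_; ∣_-_∣; z≤n; s≤s; _≟_; _<?_; _≤?_)
open import Data.Nat.Properties
open import Data.Product using (Σ; ∃; _×_; _,_; proj₁; proj₂; uncurry)
open import Data.Product.Properties using (≡-dec)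
open import Data.Sum using (_⊎_; inj₁; inj₂; [_,_])
open import Data.Empty using (⊥; ⊥-elim)
open import Data.Maybe using (just)
open import Data.Bool using (Bool; true; false)
open import Data.Maybe.Properties using (just-injective)
open import Data.List using (List; []; _∷_; _++_; foldl; applyUpTo; take; length; map; filter)
open import Data.List.Properties using (foldl-++; take-all; length-applyUpTo)
open import Data.Nat.ListAction using (sum)
open import Data.List.Relation.Unary.All as All using (All; []; _∷_)
open import Data.List.Relation.Unary.All.Properties as AllP using (¬Any⇒All¬)
open import Data.List.Relation.Unary.Any using (here; there)
open import Data.List.Relation.Unary.Any.Properties using (mapWith∈⁺; mapWith∈⁻)
open import Data.List.Relation.Unary.AllPairs as AllPairs using (AllPairs; []; _∷_)
open import Data.List.Relation.Unary.Unique.Propositional using (Unique)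
open import Data.List.Relation.Unary.Linked using (Linked)
open import Data.List.Relation.Unary.Linked.Properties using (AllPairs⇒Linked; Linked⇒AllPairs)
open import Data.List.Relation.Binary.Subset.Propositional using (_⊆_)
open import Data.List.Relation.Binary.Permutation.Propositional using (_↭_; ↭-sym; ↭-trans; ↭⇒↭ₛ)
open import Data.List.Relation.Binary.Permutation.Propositional.Properties using (∈-resp-↭; ↭-length; shift; ++⁺ˡ; drop-∷; ↭-empty-inv)
import Data.List.Relation.Binary.Permutation.Setoid.Properties as Permₛ
import Data.List.Relation.Unary.AllPairs.Properties as AllPairsP
import Data.List.Relation.Unary.Unique.Propositional.Properties as UniqueP
open import Data.List.Membership.Propositional using (_∈_; _∉_; mapWith∈)
open import Data.List.Membership.Propositional.Properties
  using (∈-∃++; ∈-++⁻; ∈-++⁺ˡ; ∈-++⁺ʳ; ∈-map⁺; ∈-map⁻; ∈-filter⁺; ∈-filter⁻; ∈-applyUpTo⁺; ∈-applyUpTo⁻)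
open import Data.List.Membership.Setoid.Properties using (length-mapWith∈)
open import Relation.Binary.Definitions using (DecidableEquality; Tri; tri<; tri≈; tri>)
open import Relation.Binary.PropositionalEquality
  using (_≡_; _≢_; refl; sym; trans; cong; cong₂; subst; subst₂; setoid; module ≡-Reasoning)
open import Relation.Binary.Construct.Closure.ReflexiveTransitive using (Star; ε; _◅_; _◅◅_; gmap; reverse)
open import Data.Nat.Induction using (<-rec; <-wellFounded)
open import Induction.WellFounded using (Acc; acc)
open import Function using (_∘_; flip; case_of_)
open import Relation.Nullary using (¬_; Dec; yes; no; does)
open import Relation.Nullary.Decidable using (map′; _×-dec_; _⊎-dec_; _→-dec_; ¬?; dec-true; dec-false; decidable-stable)
open import Relation.Nullary.Negation using (contradiction)
open import Function.Bundles using (_⇔_; mk⇔; Equivalence)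

module _ {A : Set} where

  Unique-resp-↭ : {xs ys : List A} → xs ↭ ys → Unique xs → Unique ys
  Unique-resp-↭ p = Permₛ.Unique-resp-↭ (setoid A) (↭⇒↭ₛ p)

  ∈-remove : ∀ {x y : A} (ys₁ ys₂ : List A) → y ≢ x → y ∈ ys₁ ++ x ∷ ys₂ → y ∈ ys₁ ++ ys₂
  ∈-remove ys₁ ys₂ y≢x y∈ with ∈-resp-↭ (shift _ ys₁ ys₂) y∈
  ... | here y≡x  = contradiction y≡x y≢x
  ... | there y∈′ = y∈′

  length-remove : ∀ (x : A) ys₁ ys₂ → length (ys₁ ++ x ∷ ys₂) ≡ suc (length (ys₁ ++ ys₂))
  length-remove x ys₁ ys₂ = ↭-length (shift x ys₁ ys₂)

  Unique-remove : ∀ {x : A} xs₁ xs₂ → Unique (xs₁ ++ x ∷ xs₂) → x ∉ xs₁ ++ xs₂ × Unique (xs₁ ++ xs₂)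
  Unique-remove xs₁ xs₂ u with Unique-resp-↭ (shift _ xs₁ xs₂) u
  ... | x∉ ∷ u′ = (λ x∈ → All.lookup x∉ x∈ refl) , u′

  Unique⇒length≤ : {xs ys : List A} → Unique xs → xs ⊆ ys → length xs ≤ length ys
  Unique⇒length≤ {[]} _ _ = z≤n
  Unique⇒length≤ {x ∷ xs} (x∉xs ∷ u) xs⊆ with ∈-∃++ (xs⊆ (here refl))
  ... | ys₁ , ys₂ , refl = ≤-trans (s≤s (Unique⇒length≤ u xs⊆ys₁++ys₂)) (≤-reflexive (sym (length-remove x ys₁ ys₂)))
    where
    xs⊆ys₁++ys₂ : xs ⊆ ys₁ ++ ys₂
    xs⊆ys₁++ys₂ y∈ = ∈-remove ys₁ ys₂ (λ y≡x → All.lookup x∉xs y∈ (sym y≡x)) (xs⊆ (there y∈))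

  applyUpTo-injective : ∀ (f : ℕ → A) ℓ → Unique (applyUpTo f ℓ) → ∀ {a b} → a < ℓ → b < ℓ → f a ≡ f b → a ≡ b
  applyUpTo-injective f (suc ℓ) _ {zero} {zero} _ _ _ = refl
  applyUpTo-injective f (suc ℓ) (f0∉ ∷ _) {zero} {suc b} _ (s≤s b<ℓ) f0≡ =
    contradiction (∈-applyUpTo⁺ (λ k → f (suc k)) b<ℓ) (λ fb∈ → All.lookup f0∉ fb∈ f0≡)
  applyUpTo-injective f (suc ℓ) (f0∉ ∷ _) {suc a} {zero} (s≤s a<ℓ) _ fa≡ =
    contradiction (∈-applyUpTo⁺ (λ k → f (suc k)) a<ℓ) (λ fa∈ → All.lookup f0∉ fa∈ (sym fa≡))
  applyUpTo-injective f (suc ℓ) (_ ∷ u) {suc a} {suc b} (s≤s a<ℓ) (s≤s b<ℓ) fa≡fb =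
    cong suc (applyUpTo-injective (λ k → f (suc k)) ℓ u a<ℓ b<ℓ fa≡fb)

  ∈-tail : ∀ {x y : A} {ys} → x ∈ y ∷ ys → x ≢ y → x ∈ ys
  ∈-tail (here x≡y) x≢y = contradiction x≡y x≢y
  ∈-tail (there x∈) _ = x∈

  Unique-⊇ : DecidableEquality A → {xs ys : List A} → Unique xs → xs ⊆ ys → length ys ≤ length xs → Unique ys
  Unique-⊇ _≟ₐ_ {ys = []} _ _ _ = []
  Unique-⊇ _≟ₐ_ {xs} {y ∷ ys} u xs⊆ ∣ys∣≤ = ¬Any⇒All¬ ys y∉ys ∷ unique-ys
    where
    open import Data.List.Membership.DecPropositional _≟ₐ_ using (_∈?_)
    too-short : ¬ xs ⊆ ys
    too-short xs⊆ys = <-irrefl refl (<-≤-trans (s≤s (Unique⇒length≤ u xs⊆ys)) ∣ys∣≤)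
    y∉ys : y ∉ ys
    y∉ys y∈ys = too-short λ x∈ → case xs⊆ x∈ of λ { (here refl) → y∈ys ; (there x∈ys) → x∈ys }
    unique-ys : Unique ys
    unique-ys with y ∈? xs
    ... | no y∉xs = ⊥-elim (too-short λ x∈ → ∈-tail (xs⊆ x∈) λ { refl → y∉xs x∈ })
    ... | yes y∈xs with ∈-∃++ y∈xs
    ...   | xs₁ , xs₂ , refl with Unique-remove xs₁ xs₂ u
    ...     | y∉ , u′ = Unique-⊇ _≟ₐ_ u′ ⊆ys (≤-pred (≤-trans ∣ys∣≤ (≤-reflexive (length-remove y xs₁ xs₂))))
      where
      ⊆ys : xs₁ ++ xs₂ ⊆ ys
      ⊆ys x∈ = ∈-tail (xs⊆ (∈-resp-↭ (↭-sym (shift y xs₁ xs₂)) (there x∈))) λ { refl → y∉ x∈ }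

<ₗ-trans : ∀ {x y z : Pair} → x <ₗ y → y <ₗ z → x <ₗ z
<ₗ-trans (inj₁ a<c) (inj₁ c<e)              = inj₁ (<-trans a<c c<e)
<ₗ-trans (inj₁ a<c) (inj₂ (refl , _))       = inj₁ a<c
<ₗ-trans (inj₂ (refl , _)) (inj₁ a<e)       = inj₁ a<e
<ₗ-trans (inj₂ (refl , b<d)) (inj₂ (refl , d<f)) = inj₂ (refl , <-trans b<d d<f)

<ₗ-irrefl : ∀ {x : Pair} → ¬ x <ₗ x
<ₗ-irrefl (inj₁ a<a)      = <-irrefl refl a<a
<ₗ-irrefl (inj₂ (_ , b<b)) = <-irrefl refl b<b

<ₗ-asym : ∀ {x y : Pair} → x <ₗ y → ¬ y <ₗ x
<ₗ-asym x<y y<x = <ₗ-irrefl (<ₗ-trans x<y y<x)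

<ₗ-cmp : ∀ (x y : Pair) → Tri (x <ₗ y) (x ≡ y) (y <ₗ x)
<ₗ-cmp (a , b) (c , d) with <-cmp a c
... | tri< a<c a≢c _ =
  tri< (inj₁ a<c) (λ { refl → a≢c refl }) λ { (inj₁ c<a) → <-asym a<c c<a ; (inj₂ (refl , _)) → a≢c refl }
... | tri> _ a≢c c<a =
  tri> (λ { (inj₁ a<c) → <-asym a<c c<a ; (inj₂ (refl , _)) → a≢c refl }) (λ { refl → a≢c refl }) (inj₁ c<a)
... | tri≈ _ refl _ with <-cmp b d
...   | tri< b<d b≢d _ =
  tri< (inj₂ (refl , b<d)) (λ { refl → b≢d refl }) λ { (inj₁ a<a) → <-irrefl refl a<a ; (inj₂ (_ , d<b)) → <-asym b<d d<b }
...   | tri≈ _ refl _  = tri≈ <ₗ-irrefl refl <ₗ-irrefl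
...   | tri> _ b≢d d<b =
  tri> (λ { (inj₁ a<a) → <-irrefl refl a<a ; (inj₂ (_ , b<d)) → <-asym b<d d<b }) (λ { refl → b≢d refl }) (inj₂ (refl , d<b))

_≟ₚ_ : DecidableEquality Pair
_≟ₚ_ = ≡-dec _≟_ _≟_

Sorted : List Pair → Set
Sorted = AllPairs _<ₗ_

Sorted⇒Unique : ∀ {xs} → Sorted xs → Unique xs
Sorted⇒Unique = AllPairs.map λ { x<y refl → <ₗ-irrefl x<y }

∉-above : ∀ {x y ys} → x <ₗ y → All (y <ₗ_) ys → x ∉ y ∷ ys
∉-above x<y _ (here refl)  = <ₗ-irrefl x<y
∉-above x<y y< (there x∈) = <ₗ-asym x<y (All.lookup y< x∈)

Sorted-⊆-antisym : ∀ {xs ys} → Sorted xs → Sorted ys → xs ⊆ ys → ys ⊆ xs → xs ≡ ys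
Sorted-⊆-antisym {[]} {[]} _ _ _ _ = refl
Sorted-⊆-antisym {[]} {y ∷ ys} _ _ _ ys⊆ with ys⊆ (here refl)
... | ()
Sorted-⊆-antisym {x ∷ xs} {[]} _ _ xs⊆ _ with xs⊆ (here refl)
... | ()
Sorted-⊆-antisym {x ∷ xs} {y ∷ ys} (x< ∷ sxs) (y< ∷ sys) xs⊆ ys⊆ with <ₗ-cmp x y
... | tri< x<y _ _ = contradiction (xs⊆ (here refl)) (∉-above x<y y<)
... | tri> _ _ y<x = contradiction (ys⊆ (here refl)) (∉-above y<x x<)
... | tri≈ _ refl _ = cong (x ∷_) (Sorted-⊆-antisym sxs sys (tail-⊆ x< xs⊆) (tail-⊆ y< ys⊆))
  where
  tail-⊆ : ∀ {zs zs′} → All (x <ₗ_) zs → x ∷ zs ⊆ x ∷ zs′ → zs ⊆ zs′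
  tail-⊆ x< zs⊆ z∈ = ∈-tail (zs⊆ (there z∈)) λ { refl → <ₗ-irrefl (All.lookup x< z∈) }

insert : Pair → List Pair → List Pair
insert x [] = x ∷ []
insert x (y ∷ ys) with <ₗ-cmp x y
... | tri< _ _ _ = x ∷ y ∷ ys
... | tri≈ _ _ _ = y ∷ ys
... | tri> _ _ _ = y ∷ insert x ys

∈-insert⁻ : ∀ x ys {z} → z ∈ insert x ys → z ≡ x ⊎ z ∈ ys
∈-insert⁻ x [] (here z≡x) = inj₁ z≡x
∈-insert⁻ x (y ∷ ys) z∈ with <ₗ-cmp x y | z∈
... | tri< _ _ _ | here z≡x  = inj₁ z≡x
... | tri< _ _ _ | there z∈′ = inj₂ z∈′
... | tri≈ _ _ _ | z∈′       = inj₂ z∈′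
... | tri> _ _ _ | here z≡y  = inj₂ (here z≡y)
... | tri> _ _ _ | there z∈′ with ∈-insert⁻ x ys z∈′
...   | inj₁ z≡x  = inj₁ z≡x
...   | inj₂ z∈ys = inj₂ (there z∈ys)

∈-insert⁺ : ∀ x ys {z} → z ≡ x ⊎ z ∈ ys → z ∈ insert x ys
∈-insert⁺ x [] (inj₁ z≡x) = here z≡x
∈-insert⁺ x (y ∷ ys) z∈ with <ₗ-cmp x y | z∈
... | tri< _ _ _   | inj₁ z≡x          = here z≡x
... | tri< _ _ _   | inj₂ z∈ys         = there z∈ys
... | tri≈ _ x≡y _ | inj₁ refl         = here x≡y
... | tri≈ _ _ _   | inj₂ z∈ys         = z∈ys
... | tri> _ _ _   | inj₁ z≡x          = there (∈-insert⁺ x ys (inj₁ z≡x))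
... | tri> _ _ _   | inj₂ (here z≡y)   = here z≡y
... | tri> _ _ _   | inj₂ (there z∈ys) = there (∈-insert⁺ x ys (inj₂ z∈ys))

insert-sorted : ∀ x {ys} → Sorted ys → Sorted (insert x ys)
insert-sorted x {[]} [] = [] ∷ []
insert-sorted x {y ∷ ys} (y< ∷ sys) with <ₗ-cmp x y
... | tri< x<y _ _ = (x<y ∷ All.map (<ₗ-trans x<y) y<) ∷ y< ∷ sys
... | tri≈ _ _ _   = y< ∷ sys
... | tri> _ _ y<x = All.tabulate (λ z∈ → above (∈-insert⁻ x ys z∈)) ∷ insert-sorted x sys
  where
  above : ∀ {z} → z ≡ x ⊎ z ∈ ys → y <ₗ z
  above (inj₁ refl) = y<x
  above (inj₂ z∈ys) = All.lookup y< z∈ys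

sort : List Pair → List Pair
sort [] = []
sort (x ∷ xs) = insert x (sort xs)

sort-sorted : ∀ xs → Sorted (sort xs)
sort-sorted [] = []
sort-sorted (x ∷ xs) = insert-sorted x (sort-sorted xs)

∈-sort⁻ : ∀ xs {z} → z ∈ sort xs → z ∈ xs
∈-sort⁻ (x ∷ xs) z∈ with ∈-insert⁻ x (sort xs) z∈
... | inj₁ z≡x = here z≡x
... | inj₂ z∈′ = there (∈-sort⁻ xs z∈′)

∈-sort⁺ : ∀ xs {z} → z ∈ xs → z ∈ sort xs
∈-sort⁺ (x ∷ xs) (here z≡x)  = ∈-insert⁺ x (sort xs) (inj₁ z≡x)
∈-sort⁺ (x ∷ xs) (there z∈) = ∈-insert⁺ x (sort xs) (inj₂ (∈-sort⁺ xs z∈))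

module _ {A : Set} where

  sublists : List A → List (List A)
  sublists [] = [] ∷ []
  sublists (x ∷ xs) = map (x ∷_) (sublists xs) ++ sublists xs

  []∈sublists : ∀ xs → [] ∈ sublists xs
  []∈sublists [] = here refl
  []∈sublists (x ∷ xs) = ∈-++⁺ʳ (map (x ∷_) (sublists xs)) ([]∈sublists xs)

  ∈-sublists-∷ : ∀ {x : A} xs {L} → L ∈ sublists (x ∷ xs) →
    (∃ λ L′ → L′ ∈ sublists xs × L ≡ x ∷ L′) ⊎ L ∈ sublists xs
  ∈-sublists-∷ {x} xs L∈ with ∈-++⁻ (map (x ∷_) (sublists xs)) L∈
  ... | inj₁ L∈map = inj₁ (∈-map⁻ (x ∷_) L∈map)
  ... | inj₂ L∈    = inj₂ L∈

  ∈-sublists⇒⊆ : ∀ xs {L} → L ∈ sublists xs → L ⊆ xs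
  ∈-sublists⇒⊆ [] (here refl) ()
  ∈-sublists⇒⊆ (x ∷ xs) L∈ z∈ with ∈-sublists-∷ xs L∈
  ... | inj₂ L∈′ = there (∈-sublists⇒⊆ xs L∈′ z∈)
  ... | inj₁ (L′ , L′∈ , refl) with z∈
  ...   | here z≡x   = here z≡x
  ...   | there z∈L′ = there (∈-sublists⇒⊆ xs L′∈ z∈L′)

  sublists-AllPairs : ∀ {R : A → A → Set} {xs} → AllPairs R xs → ∀ {L} → L ∈ sublists xs → AllPairs R L
  sublists-AllPairs {xs = []} [] (here refl) = []
  sublists-AllPairs {xs = x ∷ xs} (x~ ∷ pxs) L∈ with ∈-sublists-∷ xs L∈
  ... | inj₂ L∈′ = sublists-AllPairs pxs L∈′
  ... | inj₁ (L′ , L′∈ , refl) =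
    All.tabulate (λ z∈ → All.lookup x~ (∈-sublists⇒⊆ xs L′∈ z∈)) ∷ sublists-AllPairs pxs L′∈

  sublists-unique : ∀ {xs} → Unique xs → Unique (sublists xs)
  sublists-unique {[]} [] = [] ∷ []
  sublists-unique {x ∷ xs} (x∉ ∷ u) = UniqueP.++⁺ (UniqueP.map⁺ ∷-injectiveʳ (sublists-unique u)) (sublists-unique u) disjoint
    where
    open import Data.List.Properties using (∷-injectiveʳ)
    disjoint : ∀ {L} → ¬ (L ∈ map (x ∷_) (sublists xs) × L ∈ sublists xs)
    disjoint (L∈map , L∈) with ∈-map⁻ (x ∷_) L∈map
    ... | L′ , _ , refl = All.lookup x∉ (∈-sublists⇒⊆ xs L∈ (here refl)) refl

∈-sublists⁺ : ∀ {xs L} → Sorted xs → Sorted L → L ⊆ xs → L ∈ sublists xs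
∈-sublists⁺ {xs} {[]} _ _ _ = []∈sublists xs
∈-sublists⁺ {[]} {y ∷ L} _ _ L⊆ with L⊆ (here refl)
... | ()
∈-sublists⁺ {x ∷ xs} {y ∷ L} (x< ∷ sxs) (y< ∷ sL) L⊆ with L⊆ (here refl)
... | here refl = ∈-++⁺ˡ (∈-map⁺ (x ∷_) (∈-sublists⁺ sxs sL tail⊆))
  where
  tail⊆ : L ⊆ xs
  tail⊆ z∈ = ∈-tail (L⊆ (there z∈)) λ { refl → <ₗ-irrefl (All.lookup y< z∈) }
... | there y∈xs = ∈-++⁺ʳ (map (x ∷_) (sublists xs)) (∈-sublists⁺ sxs (y< ∷ sL) skip⊆)
  where
  skip⊆ : y ∷ L ⊆ xs
  skip⊆ z∈ with L⊆ z∈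
  ... | there z∈xs = z∈xs
  ... | here refl with z∈
  ...   | here refl   = y∈xs
  ...   | there z∈L   = ⊥-elim (<ₗ-asym (All.lookup x< y∈xs) (All.lookup y< z∈L))

module _ {A B : Set} where

  mapWith∈-unique : ∀ (xs : List A) (g : ∀ {x} → x ∈ xs → B) → Unique xs →
    (∀ {x y} (x∈ : x ∈ xs) (y∈ : y ∈ xs) → g x∈ ≡ g y∈ → x ≡ y) → Unique (mapWith∈ xs g)
  mapWith∈-unique [] g _ _ = []
  mapWith∈-unique (x ∷ xs) g (x∉ ∷ u) g-inj =
    All.tabulate head≢ ∷ mapWith∈-unique xs (λ y∈ → g (there y∈)) u (λ x∈ y∈ → g-inj (there x∈) (there y∈))
    where
    head≢ : ∀ {z} → z ∈ mapWith∈ xs (λ y∈ → g (there y∈)) → g (here refl) ≢ z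
    head≢ z∈ g≡z with mapWith∈⁻ xs _ z∈
    ... | y , y∈ , z≡g = All.lookup x∉ y∈ (g-inj (here refl) (there y∈) (trans g≡z z≡g))

  HasSize-bijection : ∀ {P : A → Set} {Q : B → Set} {k} → HasSize P k → (R : A → B → Set) →
    (∀ {x} → P x → ∃ (R x)) →
    (∀ {x y y′} → P x → R x y → R x y′ → y ≡ y′) →
    (∀ {x x′ y} → P x → P x′ → R x y → R x′ y → x ≡ x′) →
    (∀ {x y} → P x → R x y → Q y) →
    (∀ {y} → Q y → ∃ λ x → P x × R x y) →
    HasSize Q k
  HasSize-bijection {P} {Q} (L , u , L⇔P , |L|≡k) R total functional injective into onto =
    mapWith∈ L image , unique , (λ y → mk⇔ (to y) (from y)) , trans (length-mapWith∈ (setoid A) L) |L|≡k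
    where
    inP : ∀ {x} → x ∈ L → P x
    inP {x} = Equivalence.to (L⇔P x)
    image : ∀ {x} → x ∈ L → B
    image x∈ = proj₁ (total (inP x∈))
    unique : Unique (mapWith∈ L image)
    unique = mapWith∈-unique L image u λ x∈ y∈ eq →
      injective (inP x∈) (inP y∈) (proj₂ (total (inP x∈))) (subst (R _) (sym eq) (proj₂ (total (inP y∈))))
    to : ∀ y → y ∈ mapWith∈ L image → Q y
    to y y∈ with mapWith∈⁻ L image y∈
    ... | x , x∈ , refl = into (inP x∈) (proj₂ (total (inP x∈)))
    from : ∀ y → Q y → y ∈ mapWith∈ L image
    from y Qy with onto Qy
    ... | x , Px , Rxy = mapWith∈⁺ image (x , x∈ , functional Px Rxy (proj₂ (total (inP x∈))))
      where x∈ = Equivalence.from (L⇔P x) Px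

TallyIs-indicator : ∀ {A : Set} {P S : A → Set} {ρ : A → ℕ} {k} → IsIndicator ρ S → (∀ {x} → P x → S x) →
  HasSize P k → TallyIs P ρ k
TallyIs-indicator {ρ = ρ} ind P⇒S (L , u , L⇔P , |L|≡k) = L , u , L⇔P , trans (sum-ones L (λ x∈ → x∈)) |L|≡k
  where
  sum-ones : ∀ L′ → L′ ⊆ L → sum (map ρ L′) ≡ length L′
  sum-ones [] _ = refl
  sum-ones (x ∷ L′) L′⊆ = cong₂ _+_ (proj₁ (ind x) (P⇒S (Equivalence.to (L⇔P x) (L′⊆ (here refl)))))
                                     (sum-ones L′ (λ y∈ → L′⊆ (there y∈)))

-- Inversions

Before-∷⁻ : ∀ {z : ℕ} {zs x y} → Before (z ∷ zs) x y → (z ≡ x × y ∈ zs) ⊎ Before zs x y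
Before-∷⁻ ([] , ys , refl , y∈) = inj₁ (refl , y∈)
Before-∷⁻ (_ ∷ xs , ys , refl , y∈) = inj₂ (xs , ys , refl , y∈)

Before-head : ∀ {x : ℕ} {zs y} → y ∈ zs → Before (x ∷ zs) x y
Before-head {zs = zs} y∈ = [] , zs , refl , y∈

Before-∷⁺ : ∀ {z : ℕ} {zs x y} → Before zs x y → Before (z ∷ zs) x y
Before-∷⁺ {z} (xs , ys , refl , y∈) = z ∷ xs , ys , refl , y∈

Before-adjacent : ∀ A {x y : ℕ} {B} → Before (A ++ x ∷ y ∷ B) x y
Before-adjacent A = A , _ , refl , here refl

Before⇒∈ : ∀ {u : List ℕ} {x y} → Before u x y → x ∈ u × y ∈ u
Before⇒∈ (xs , ys , refl , y∈) = ∈-++⁺ʳ xs (here refl) , ∈-++⁺ʳ xs (there y∈)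

Before? : ∀ (u : List ℕ) x y → Dec (Before u x y)
Before? [] x y = no λ { ([] , _ , () , _) ; (_ ∷ _ , _ , () , _) }
Before? (z ∷ zs) x y =
  map′ (λ { (inj₁ (refl , y∈)) → Before-head y∈ ; (inj₂ bf) → Before-∷⁺ bf }) Before-∷⁻
       (((z ≟ x) ×-dec (y ∈ℕ? zs)) ⊎-dec Before? zs x y)
  where open import Data.List.Membership.DecPropositional _≟_ using () renaming (_∈?_ to _∈ℕ?_)

InInv? : ∀ u p → Dec (InInv u p)
InInv? u (a , b) = (a <? b) ×-dec Before? u b a

∈-swap : ∀ A {c d : ℕ} {B y} → y ∈ A ++ c ∷ d ∷ B → y ∈ A ++ d ∷ c ∷ B
∈-swap A {c} {d} = ∈-resp-↭ (++⁺ˡ A (_↭_.swap c d _↭_.refl))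

Before-swap⁻ : ∀ A {c d B x y} → Before (A ++ d ∷ c ∷ B) x y → (x ≡ d × y ≡ c) ⊎ Before (A ++ c ∷ d ∷ B) x y
Before-swap⁻ [] bf with Before-∷⁻ bf
... | inj₁ (refl , here refl) = inj₁ (refl , refl)
... | inj₁ (refl , there y∈) = inj₂ (Before-∷⁺ (Before-head y∈))
... | inj₂ bf′ with Before-∷⁻ bf′
...   | inj₁ (refl , y∈) = inj₂ (Before-head (there y∈))
...   | inj₂ bf″ = inj₂ (Before-∷⁺ (Before-∷⁺ bf″))
Before-swap⁻ (a ∷ A) bf with Before-∷⁻ bf
... | inj₁ (refl , y∈) = inj₂ (Before-head (∈-swap A y∈))
... | inj₂ bf′ with Before-swap⁻ A bf′
...   | inj₁ xy≡dc = inj₁ xy≡dc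
...   | inj₂ bf″ = inj₂ (Before-∷⁺ bf″)

Before-swap⁺ : ∀ A {c d B x y} → Before (A ++ c ∷ d ∷ B) x y → ¬ (x ≡ c × y ≡ d) → Before (A ++ d ∷ c ∷ B) x y
Before-swap⁺ [] bf xy≢cd with Before-∷⁻ bf
... | inj₁ (refl , here refl) = contradiction (refl , refl) xy≢cd
... | inj₁ (refl , there y∈) = Before-∷⁺ (Before-head y∈)
... | inj₂ bf′ with Before-∷⁻ bf′
...   | inj₁ (refl , y∈) = Before-head (there y∈)
...   | inj₂ bf″ = Before-∷⁺ (Before-∷⁺ bf″)
Before-swap⁺ (a ∷ A) bf xy≢cd with Before-∷⁻ bf
... | inj₁ (refl , y∈) = Before-head (∈-swap A y∈)
... | inj₂ bf′ = Before-∷⁺ (Before-swap⁺ A bf′ xy≢cd)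

Inv-swap⁻ : ∀ A {c d B p} → InInv (A ++ d ∷ c ∷ B) p → p ≡ (c , d) ⊎ InInv (A ++ c ∷ d ∷ B) p
Inv-swap⁻ A (a<b , bf) with Before-swap⁻ A bf
... | inj₁ (refl , refl) = inj₁ refl
... | inj₂ bf′ = inj₂ (a<b , bf′)

Inv-swap⁺ : ∀ A {c d B p} → InInv (A ++ c ∷ d ∷ B) p → p ≢ (d , c) → InInv (A ++ d ∷ c ∷ B) p
Inv-swap⁺ A (a<b , bf) p≢dc = a<b , Before-swap⁺ A bf λ { (refl , refl) → p≢dc refl }

Inv-adjacent : ∀ A {c d B} → c < d → InInv (A ++ d ∷ c ∷ B) (c , d)
Inv-adjacent A c<d = c<d , Before-adjacent A

idPerm-unique : ∀ n → Unique (idPerm n)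
idPerm-unique n = UniqueP.applyUpTo⁺₁ suc n (λ i<j _ e → <-irrefl (suc-injective e) i<j)

Before-AllPairs-< : ∀ {u : List ℕ} {x y} → AllPairs _<_ u → Before u x y → x < y
Before-AllPairs-< {z ∷ zs} (z< ∷ szs) bf with Before-∷⁻ bf
... | inj₁ (refl , y∈) = All.lookup z< y∈
... | inj₂ bf′ = Before-AllPairs-< szs bf′
Before-AllPairs-< {[]} [] ([] , _ , () , _)
Before-AllPairs-< {[]} [] (_ ∷ _ , _ , () , _)

idPerm-noInv : ∀ n p → ¬ InInv (idPerm n) p
idPerm-noInv n (a , b) (a<b , bf) =
  <-asym a<b (Before-AllPairs-< (AllPairsP.applyUpTo⁺₁ suc n (λ i<j _ → s≤s i<j)) bf)

Unique-∷⇒≢ : ∀ {z : ℕ} {zs y} → Unique (z ∷ zs) → y ∈ zs → y ≢ z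
Unique-∷⇒≢ (z∉zs ∷ _) y∈zs refl = All.lookup z∉zs y∈zs refl

smaller-head-∉Inv : ∀ {z zs z′ zs′} → Unique (z ∷ zs) → z ∈ zs′ → z < z′ →
  ¬ (InInv (z′ ∷ zs′) (z , z′) → InInv (z ∷ zs) (z , z′))
smaller-head-∉Inv u z∈zs′ z<z′ from with Before-∷⁻ (proj₂ (from (z<z′ , Before-head z∈zs′)))
... | inj₁ (z≡z′ , _) = <-irrefl z≡z′ z<z′
... | inj₂ bf = Unique-∷⇒≢ u (proj₂ (Before⇒∈ bf)) refl

Inv-injective : ∀ {u u′ : List ℕ} → Unique u → u ↭ u′ → (∀ p → InInv u p ⇔ InInv u′ p) → u ≡ u′
Inv-injective {[]} _ u↭u′ _ = sym (↭-empty-inv (↭-sym u↭u′))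
Inv-injective {z ∷ zs} {[]} _ u↭u′ _ with ↭-empty-inv u↭u′
... | ()
Inv-injective {z ∷ zs} {z′ ∷ zs′} u u↭u′ same with <-cmp z z′
... | tri< z<z′ z≢z′ _ =
  contradiction (Equivalence.from (same _)) (smaller-head-∉Inv u (∈-tail (∈-resp-↭ u↭u′ (here refl)) z≢z′) z<z′)
... | tri> _ z≢z′ z′<z =
  contradiction (Equivalence.to (same _))
    (smaller-head-∉Inv (Unique-resp-↭ u↭u′ u) (∈-tail (∈-resp-↭ (↭-sym u↭u′) (here refl)) (z≢z′ ∘ sym)) z′<z)
... | tri≈ _ refl _ = cong (z ∷_) (Inv-injective (AllPairs.tail u) (drop-∷ u↭u′) λ p →
  mk⇔ (tail u (Equivalence.to (same p))) (tail (Unique-resp-↭ u↭u′ u) (Equivalence.from (same p))))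
  where
  tail : ∀ {vs vs′} → Unique (z ∷ vs) → ∀ {p} → (InInv (z ∷ vs) p → InInv (z ∷ vs′) p) → InInv vs p → InInv vs′ p
  tail u {a , b} to (a<b , bf) with Before-∷⁻ (proj₂ (to (a<b , Before-∷⁺ bf)))
  ... | inj₁ (refl , _) = contradiction refl (Unique-∷⇒≢ u (proj₁ (Before⇒∈ bf)))
  ... | inj₂ bf′ = a<b , bf′

-- the entries in positions k and k + 1, numbered from 1 as for swapAt; junk value (0 , 0) out of range
pairAt : ℕ → List ℕ → Pair
pairAt (suc zero)    (x ∷ y ∷ _) = (x , y)
pairAt (suc (suc k)) (_ ∷ xs)    = pairAt (suc k) xs
pairAt _             _           = (0 , 0)

swapAt-↭ : ∀ k (u : List ℕ) → swapAt k u ↭ u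
swapAt-↭ (suc zero)    (x ∷ y ∷ xs) = _↭_.swap y x _↭_.refl
swapAt-↭ (suc (suc k)) (x ∷ xs)     = _↭_.prep x (swapAt-↭ (suc k) xs)
swapAt-↭ zero          u            = _↭_.refl
swapAt-↭ (suc zero)    []           = _↭_.refl
swapAt-↭ (suc zero)    (x ∷ [])     = _↭_.refl
swapAt-↭ (suc (suc k)) []           = _↭_.refl

swapAt-split : ∀ k (u : List ℕ) → 1 ≤ k → suc k ≤ length u →
  ∃ λ A → ∃ λ c → ∃ λ d → ∃ λ B →
    u ≡ A ++ c ∷ d ∷ B × swapAt k u ≡ A ++ d ∷ c ∷ B × pairAt k u ≡ (c , d)
swapAt-split (suc zero) (c ∷ d ∷ B) _ _ = [] , c , d , B , refl , refl , refl
swapAt-split (suc zero) (x ∷ []) _ (s≤s ())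
swapAt-split (suc (suc k)) (x ∷ u) _ (s≤s k<∣u∣) with swapAt-split (suc k) u (s≤s z≤n) k<∣u∣
... | A , c , d , B , refl , swap≡ , pair≡ = x ∷ A , c , d , B , refl , cong (x ∷_) swap≡ , pair≡

swapAt-comm : ∀ a b (u : List ℕ) → 2 ≤ ∣ a - b ∣ → swapAt a (swapAt b u) ≡ swapAt b (swapAt a u)
swapAt-comm zero b u _ = refl
swapAt-comm (suc a) zero u _ = refl
swapAt-comm 1 (suc (suc (suc b))) []          _ = refl
swapAt-comm 1 (suc (suc (suc b))) (x ∷ [])    _ = refl
swapAt-comm 1 (suc (suc (suc b))) (x ∷ y ∷ r) _ = refl
swapAt-comm (suc (suc (suc a))) 1 []          _ = refl
swapAt-comm (suc (suc (suc a))) 1 (x ∷ [])    _ = refl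
swapAt-comm (suc (suc (suc a))) 1 (x ∷ y ∷ r) _ = refl
swapAt-comm (suc (suc a)) (suc (suc b)) [] _ = refl
swapAt-comm (suc (suc a)) (suc (suc b)) (x ∷ u) far = cong (x ∷_) (swapAt-comm (suc a) (suc b) u far)
swapAt-comm 1 1 u ()
swapAt-comm 1 2 u (s≤s ())
swapAt-comm 2 1 u (s≤s ())

pairAt-swapAt : ∀ a b (u : List ℕ) → 2 ≤ ∣ a - b ∣ → pairAt b (swapAt a u) ≡ pairAt b u
pairAt-swapAt zero b u _ = refl
pairAt-swapAt (suc a) zero u _ = refl
pairAt-swapAt 1 (suc (suc (suc b))) []          _ = refl
pairAt-swapAt 1 (suc (suc (suc b))) (x ∷ [])    _ = refl
pairAt-swapAt 1 (suc (suc (suc b))) (x ∷ y ∷ r) _ = refl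
pairAt-swapAt (suc (suc (suc a))) 1 []              _ = refl
pairAt-swapAt (suc (suc (suc a))) 1 (x ∷ [])        _ = refl
pairAt-swapAt (suc (suc (suc a))) 1 (x ∷ y ∷ [])    _ = refl
pairAt-swapAt (suc (suc (suc a))) 1 (x ∷ y ∷ z ∷ r) _ = refl
pairAt-swapAt (suc (suc a)) (suc (suc b)) [] _ = refl
pairAt-swapAt (suc (suc a)) (suc (suc b)) (x ∷ u) far = pairAt-swapAt (suc a) (suc b) u far
pairAt-swapAt 1 1 u ()
pairAt-swapAt 1 2 u (s≤s ())
pairAt-swapAt 2 1 u (s≤s ())

applySwaps : List ℕ → List ℕ → List ℕ
applySwaps = foldl (λ u i → swapAt i u)

applySwaps-↭ : ∀ u ws → applySwaps u ws ↭ u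
applySwaps-↭ u [] = _↭_.refl
applySwaps-↭ u (i ∷ ws) = ↭-trans (applySwaps-↭ (swapAt i u) ws) (swapAt-↭ i u)

nth : List ℕ → ℕ → ℕ
nth []       _       = 0
nth (x ∷ xs) zero    = x
nth (x ∷ xs) (suc k) = nth xs k

nth∈ : ∀ (xs : List ℕ) {k} → k < length xs → nth xs k ∈ xs
nth∈ (x ∷ xs) {zero}  _           = here refl
nth∈ (x ∷ xs) {suc k} (s≤s k<∣xs∣) = there (nth∈ xs k<∣xs∣)

!-nth : ∀ (xs : List ℕ) {k} → k < length xs → xs ! k ≡ just (nth xs k)
!-nth (x ∷ xs) {zero}  _           = refl
!-nth (x ∷ xs) {suc k} (s≤s k<∣xs∣) = !-nth xs k<∣xs∣

applySwaps-take-suc : ∀ u (ws : List ℕ) {k} → k < length ws →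
  applySwaps u (take (suc k) ws) ≡ swapAt (nth ws k) (applySwaps u (take k ws))
applySwaps-take-suc u (i ∷ ws) {zero}  _           = refl
applySwaps-take-suc u (i ∷ ws) {suc k} (s≤s k<∣ws∣) = applySwaps-take-suc (swapAt i u) ws k<∣ws∣

-- x_{k+1} of the paper (cf. IsX): the pair of entries exchanged by the (k+1)-st letter of ws
addedInversion : ℕ → List ℕ → ℕ → Pair
addedInversion n ws k = pairAt (nth ws k) (evalWord n (take k ws))

ascending : Pair → Pair
ascending (c , d) with c <? d
... | yes _ = (c , d)
... | no _  = (d , c)

ascending-< : ∀ {c d} → c < d → ascending (c , d) ≡ (c , d)
ascending-< {c} {d} c<d with c <? d
... | yes _   = refl
... | no c≮d  = contradiction c<d c≮d

ascending-> : ∀ {c d} → d < c → ascending (c , d) ≡ (d , c)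
ascending-> {c} {d} d<c with c <? d
... | yes c<d = contradiction c<d (<-asym d<c)
... | no _    = refl

module Prefixes {n : ℕ} {w ws : List ℕ} (red : IsReducedWord n w ws) where

  ℓ : ℕ
  ℓ = length ws

  prefix : ℕ → List ℕ
  prefix m = evalWord n (take m ws)

  x : ℕ → Pair
  x = addedInversion n ws

  prefix-full : ∀ {m} → ℓ ≤ m → prefix m ≡ w
  prefix-full ℓ≤m = trans (cong (evalWord n) (take-all _ ws ℓ≤m)) (proj₁ (proj₂ red))

  prefix-↭ : ∀ m → prefix m ↭ idPerm n
  prefix-↭ m = applySwaps-↭ (idPerm n) (take m ws)

  prefix-unique : ∀ m → Unique (prefix m)
  prefix-unique m = Unique-resp-↭ (↭-sym (prefix-↭ m)) (idPerm-unique n)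

  prefix-step : ∀ {k} → k < ℓ → ∃ λ A → ∃ λ c → ∃ λ d → ∃ λ B →
    prefix k ≡ A ++ c ∷ d ∷ B × prefix (suc k) ≡ A ++ d ∷ c ∷ B × x k ≡ (c , d)
  prefix-step {k} k<ℓ with swapAt-split (nth ws k) (prefix k) 1≤i (subst (suc (nth ws k) ≤_) (sym ∣prefix∣) i<n)
    where
    1≤i = proj₁ (All.lookup (proj₁ red) (nth∈ ws k<ℓ))
    i<n = proj₂ (All.lookup (proj₁ red) (nth∈ ws k<ℓ))
    ∣prefix∣ : length (prefix k) ≡ n
    ∣prefix∣ = trans (↭-length (prefix-↭ k)) (length-applyUpTo suc n)
  ... | A , c , d , B , split , swapped , pair =
    A , c , d , B , split , trans (applySwaps-take-suc (idPerm n) ws k<ℓ) swapped , pair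

  Inv-prefix⊆ascending : ∀ {m} → m ≤ ℓ → ∀ {p} → InInv (prefix m) p → ∃ λ k → k < m × p ≡ ascending (x k)
  Inv-prefix⊆ascending {zero} _ {p} inv = contradiction inv (idPerm-noInv n p)
  Inv-prefix⊆ascending {suc m} m<ℓ {a , b} inv with prefix-step m<ℓ
  ... | A , c , d , B , split , swapped , pair with Inv-swap⁻ A (subst (λ u → InInv u (a , b)) swapped inv)
  ...   | inj₁ refl = m , ≤-refl , trans (sym (ascending-< (proj₁ inv))) (cong ascending (sym pair))
  ...   | inj₂ inv′ with Inv-prefix⊆ascending (<⇒≤ m<ℓ) (subst (λ u → InInv u (a , b)) (sym split) inv′)
  ...     | k , k<m , p≡ = k , m<n⇒m<1+n k<m , p≡

  -- Reducedness enters here: Inv(w) has ℓ elements, all among these ℓ pairs.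
  ascending-x-injective : ∀ {k k′} → k < ℓ → k′ < ℓ → ascending (x k) ≡ ascending (x k′) → k ≡ k′
  ascending-x-injective with proj₂ (proj₂ red)
  ... | L , uL , L⇔Inv , ∣L∣≡ℓ = applyUpTo-injective (λ k → ascending (x k)) ℓ
    (Unique-⊇ _≟ₚ_ uL covers (≤-reflexive (trans (length-applyUpTo (λ k → ascending (x k)) ℓ) (sym ∣L∣≡ℓ))))
    where
    covers : L ⊆ applyUpTo (λ k → ascending (x k)) ℓ
    covers {p} p∈ with Inv-prefix⊆ascending ≤-refl (subst (λ u → InInv u p) (sym (prefix-full ≤-refl)) (Equivalence.to (L⇔Inv p) p∈))
    ... | k , k<ℓ , refl = ∈-applyUpTo⁺ _ k<ℓ

  x-increasing : ∀ {k} → k < ℓ → uncurry _<_ (x k)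
  x-increasing {k} k<ℓ with prefix-step k<ℓ
  ... | A , c , d , B , split , _ , refl with <-cmp c d
  ...   | tri< c<d _ _ = c<d
  ...   | tri≈ _ c≡d _ = contradiction (∈-++⁺ʳ A (here c≡d)) (proj₁ (Unique-remove A (d ∷ B) (subst Unique split (prefix-unique k))))
  ...   | tri> _ _ d<c with Inv-prefix⊆ascending (<⇒≤ k<ℓ) (subst (λ u → InInv u (d , c)) (sym split) (d<c , Before-adjacent A))
  ...     | k′ , k′<k , dc≡ =
    contradiction (ascending-x-injective (<-trans k′<k k<ℓ) k<ℓ (trans (sym dc≡) (sym (ascending-> d<c)))) (<⇒≢ k′<k)

  ascending-x : ∀ {k} → k < ℓ → ascending (x k) ≡ x k
  ascending-x k<ℓ = ascending-< (x-increasing k<ℓ)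

  x-injective : ∀ {k k′} → k < ℓ → k′ < ℓ → x k ≡ x k′ → k ≡ k′
  x-injective k<ℓ k′<ℓ eq = ascending-x-injective k<ℓ k′<ℓ (trans (ascending-x k<ℓ) (trans eq (sym (ascending-x k′<ℓ))))

  Inv-prefix⁻ : ∀ {m} → m ≤ ℓ → ∀ {p} → InInv (prefix m) p → ∃ λ k → k < m × p ≡ x k
  Inv-prefix⁻ m≤ℓ inv with Inv-prefix⊆ascending m≤ℓ inv
  ... | k , k<m , p≡ = k , k<m , trans p≡ (ascending-x (<-≤-trans k<m m≤ℓ))

  Inv-prefix⁺ : ∀ {m} → m ≤ ℓ → ∀ {k} → k < m → InInv (prefix m) (x k)
  Inv-prefix⁺ {suc m} m<ℓ {k} k<1+m with prefix-step m<ℓ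
  ... | A , c , d , B , split , swapped , pair with m ≟ k
  ...   | yes refl = subst (λ u → InInv u (x m)) (sym swapped)
                       (subst (InInv (A ++ d ∷ c ∷ B)) (sym pair) (Inv-adjacent A (subst (uncurry _<_) pair (x-increasing m<ℓ))))
  ...   | no m≢k = subst (λ u → InInv u (x k)) (sym swapped)
                     (Inv-swap⁺ A (subst (λ u → InInv u (x k)) split (Inv-prefix⁺ (<⇒≤ m<ℓ) k<m)) xk≢dc)
    where
    k<m : k < m
    k<m = ≤∧≢⇒< (≤-pred k<1+m) (λ k≡m → m≢k (sym k≡m))
    xk≢dc : x k ≢ (d , c)
    xk≢dc xk≡dc = <-asym (subst (uncurry _<_) xk≡dc (x-increasing (<-trans k<m m<ℓ)))
                         (subst (uncurry _<_) pair (x-increasing m<ℓ))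

  IsX⇒x : ∀ {k p} → IsX n ws k p → k < ℓ × p ≡ x k
  IsX⇒x {k} {p} (inv , ¬inv) = k<ℓ , p≡xk (Inv-prefix⁻ k<ℓ inv)
    where
    k<ℓ : k < ℓ
    k<ℓ = decidable-stable (k <? ℓ) λ k≮ℓ →
      ¬inv (subst (λ u → InInv u p) (trans (prefix-full (m≤n⇒m≤1+n (≮⇒≥ k≮ℓ))) (sym (prefix-full (≮⇒≥ k≮ℓ)))) inv)
    p≡xk : (∃ λ k′ → k′ < suc k × p ≡ x k′) → p ≡ x k
    p≡xk (k′ , k′<1+k , p≡xk′) with m<1+n⇒m<n∨m≡n k′<1+k
    ... | inj₂ refl = p≡xk′
    ... | inj₁ k′<k = contradiction (subst (InInv (prefix k)) (sym p≡xk′) (Inv-prefix⁺ (<⇒≤ k<ℓ) k′<k)) ¬inv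

  x-IsX : ∀ {k} → k < ℓ → IsX n ws k (x k)
  x-IsX {k} k<ℓ = Inv-prefix⁺ k<ℓ ≤-refl , not-yet
    where
    not-yet : ¬ InInv (prefix k) (x k)
    not-yet inv with Inv-prefix⁻ (<⇒≤ k<ℓ) inv
    ... | k′ , k′<k , xk≡ = <⇒≢ k′<k (sym (x-injective k<ℓ (<-trans k′<k k<ℓ) xk≡))

  Inv-w⁻ : ∀ {p} → InInv w p → ∃ λ k → k < ℓ × p ≡ x k
  Inv-w⁻ {p} inv = Inv-prefix⁻ ≤-refl (subst (λ u → InInv u p) (sym (prefix-full ≤-refl)) inv)

  Inv-w⁺ : ∀ {k} → k < ℓ → InInv w (x k)
  Inv-w⁺ {k} k<ℓ = subst (λ u → InInv u (x k)) (prefix-full ≤-refl) (Inv-prefix⁺ ≤-refl k<ℓ)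

  Inv-prefix⊆Inv-w : ∀ {m} → m ≤ ℓ → ∀ {p} → InInv (prefix m) p → InInv w p
  Inv-prefix⊆Inv-w m≤ℓ inv with Inv-prefix⁻ m≤ℓ inv
  ... | k , k<m , refl = Inv-w⁺ (<-≤-trans k<m m≤ℓ)

-- Commutation classes

τ : ℕ → ℕ → ℕ
τ zero    zero          = 1
τ zero    (suc zero)    = 0
τ zero    (suc (suc m)) = suc (suc m)
τ (suc p) zero          = zero
τ (suc p) (suc m)       = suc (τ p m)

τ-< : ∀ p {m L} → suc p < L → m < L → τ p m < L
τ-< zero    {zero}          1<L _   = 1<L
τ-< zero    {suc zero}      _   m<L = <-trans (s≤s z≤n) m<L
τ-< zero    {suc (suc m)}   _   m<L = m<L
τ-< (suc p) {zero}          _   m<L = m<L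
τ-< (suc p) {suc m} {suc L} (s≤s p<L) (s≤s m<L) = s≤s (τ-< p p<L m<L)

τ-mono : ∀ p {m m′} → m < m′ → ¬ (m ≡ p × m′ ≡ suc p) → τ p m < τ p m′
τ-mono zero    {zero}  {suc zero}     _ not-p = contradiction (refl , refl) not-p
τ-mono zero    {zero}  {suc (suc m′)} _ _ = s≤s (s≤s z≤n)
τ-mono zero    {suc zero}    {suc (suc m′)} _ _ = s≤s z≤n
τ-mono zero    {suc (suc m)} {suc (suc m′)} m<m′ _ = m<m′
τ-mono (suc p) {zero}  {suc m′} _ _ = s≤s z≤n
τ-mono (suc p) {suc m} {suc m′} (s≤s m<m′) not-p = s≤s (τ-mono p m<m′ λ { (refl , refl) → not-p (refl , refl) })
τ-mono _       {_}     {zero}   () _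
τ-mono zero    {suc zero}    {suc zero} (s≤s ()) _
τ-mono zero    {suc (suc m)} {suc zero} (s≤s ()) _

nth-++-∷ : ∀ xs {a : ℕ} {r} → nth (xs ++ a ∷ r) (length xs) ≡ a
nth-++-∷ []       = refl
nth-++-∷ (_ ∷ xs) = nth-++-∷ xs

nth-++-∷-∷ : ∀ xs {a b : ℕ} {r} → nth (xs ++ a ∷ b ∷ r) (suc (length xs)) ≡ b
nth-++-∷-∷ []       = refl
nth-++-∷-∷ (_ ∷ xs) = nth-++-∷-∷ xs

length-++-∷-∷ : ∀ xs {a b : ℕ} {r} → suc (length xs) < length (xs ++ a ∷ b ∷ r)
length-++-∷-∷ []       = s≤s (s≤s z≤n)
length-++-∷-∷ (_ ∷ xs) = s≤s (length-++-∷-∷ xs)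

length-commute : ∀ xs {a b : ℕ} {ys} → length (xs ++ b ∷ a ∷ ys) ≡ length (xs ++ a ∷ b ∷ ys)
length-commute xs {a} {b} = ↭-length (++⁺ˡ xs (_↭_.swap b a _↭_.refl))

-- Positions are tracked from an arbitrary starting permutation u, so that a prefix of the word can be peeled off.
x-from : List ℕ → List ℕ → ℕ → Pair
x-from u ws k = pairAt (nth ws k) (applySwaps u (take k ws))

module _ {a b : ℕ} {ys : List ℕ} (far : 2 ≤ ∣ a - b ∣) where

  x-from-commute : ∀ u xs m → x-from u (xs ++ b ∷ a ∷ ys) (τ (length xs) m) ≡ x-from u (xs ++ a ∷ b ∷ ys) m
  x-from-commute u [] zero = pairAt-swapAt b a u (subst (2 ≤_) (∣-∣-comm a b) far)
  x-from-commute u [] (suc zero) = sym (pairAt-swapAt a b u far)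
  x-from-commute u [] (suc (suc m)) = cong (λ v → pairAt (nth ys m) (applySwaps v (take m ys))) (swapAt-comm a b u far)
  x-from-commute u (c ∷ xs) zero = refl
  x-from-commute u (c ∷ xs) (suc m) = x-from-commute (swapAt c u) xs m

  nth-commute : ∀ xs m → nth (xs ++ b ∷ a ∷ ys) (τ (length xs) m) ≡ nth (xs ++ a ∷ b ∷ ys) m
  nth-commute [] zero = refl
  nth-commute [] (suc zero) = refl
  nth-commute [] (suc (suc m)) = refl
  nth-commute (c ∷ xs) zero = refl
  nth-commute (c ∷ xs) (suc m) = nth-commute xs m

  x-commute : ∀ n xs m → addedInversion n (xs ++ b ∷ a ∷ ys) (τ (length xs) m) ≡ addedInversion n (xs ++ a ∷ b ∷ ys) m
  x-commute n = x-from-commute (idPerm n)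

commute-evalWord : ∀ n xs {a b : ℕ} ys → 2 ≤ ∣ a - b ∣ → evalWord n (xs ++ b ∷ a ∷ ys) ≡ evalWord n (xs ++ a ∷ b ∷ ys)
commute-evalWord n xs {a} {b} ys far = begin
  applySwaps (idPerm n) (xs ++ b ∷ a ∷ ys)  ≡⟨ foldl-++ _ (idPerm n) xs (b ∷ a ∷ ys) ⟩
  applySwaps (swapAt a (swapAt b u)) ys      ≡⟨ cong (λ v → applySwaps v ys) (swapAt-comm a b u far) ⟩
  applySwaps (swapAt b (swapAt a u)) ys      ≡⟨ sym (foldl-++ _ (idPerm n) xs (a ∷ b ∷ ys)) ⟩
  applySwaps (idPerm n) (xs ++ a ∷ b ∷ ys)  ∎
  where
  open ≡-Reasoning
  u = applySwaps (idPerm n) xs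

CommStep-reduced : ∀ {n w j j′} → CommStep j j′ → IsReducedWord n w j → IsReducedWord n w j′
CommStep-reduced {n} {w} (comm xs ys a b far) (valid , eval≡ , size) =
  valid′ , trans (commute-evalWord n xs ys far) eval≡ , subst (HasSize (InInv w)) (sym (length-commute xs)) size
  where
  valid′ : All (ValidLetter n) (xs ++ b ∷ a ∷ ys)
  valid′ with AllP.++⁻ xs valid
  ... | vxs , va ∷ vb ∷ vys = AllP.++⁺ vxs (vb ∷ va ∷ vys)

CommClass-reduced : ∀ {n w i j} → InCommClass i j → IsReducedWord n w i → IsReducedWord n w j
CommClass-reduced ε red = red
CommClass-reduced (step ◅ steps) red = CommClass-reduced steps (CommStep-reduced step red)

-- σ sends the position of each letter of i to its position in j.
record Matching (n : ℕ) (i j : List ℕ) : Set where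
  field
    length≡ : length j ≡ length i
    σ       : ℕ → ℕ
    σ-<     : ∀ {a} → a < length i → σ a < length i
    nth-σ   : ∀ {a} → a < length i → nth j (σ a) ≡ nth i a
    x-σ     : ∀ {a} → a < length i → addedInversion n j (σ a) ≡ addedInversion n i a
    σ-mono  : ∀ {a b} → a < b → b < length i → ∣ nth i a - nth i b ∣ ≤ 1 → σ a < σ b

Matching-refl : ∀ {n i} → Matching n i i
Matching-refl = record
  { length≡ = refl ; σ = λ a → a ; σ-< = λ a<ℓ → a<ℓ ; nth-σ = λ _ → refl ; x-σ = λ _ → refl ; σ-mono = λ a<b _ _ → a<b }

Matching-CommStep : ∀ {n i j j′} → CommStep j j′ → Matching n i j → Matching n i j′
Matching-CommStep {n} {i} (comm xs ys a b far) m = record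
  { length≡ = trans (length-commute xs) length≡
  ; σ = λ c → τ p (σ c)
  ; σ-< = λ c<ℓ → τ-< p (subst (suc p <_) length≡ (length-++-∷-∷ xs)) (σ-< c<ℓ)
  ; nth-σ = λ {c} c<ℓ → trans (nth-commute far xs (σ c)) (nth-σ c<ℓ)
  ; x-σ = λ {c} c<ℓ → trans (x-commute far n xs (σ c)) (x-σ c<ℓ)
  ; σ-mono = λ c<d d<ℓ close → τ-mono p (σ-mono c<d d<ℓ close) (not-split c<d d<ℓ close)
  }
  where
  open Matching m
  p = length xs
  not-split : ∀ {c d} → c < d → d < length i → ∣ nth i c - nth i d ∣ ≤ 1 → ¬ (σ c ≡ p × σ d ≡ suc p)
  not-split {c} {d} c<d d<ℓ close (σc≡p , σd≡1+p) = <-irrefl refl (<-≤-trans far (subst (_≤ 1) (cong₂ ∣_-_∣ c↦a d↦b) close))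
    where
    c↦a : nth i c ≡ a
    c↦a = trans (sym (nth-σ (<-trans c<d d<ℓ))) (trans (cong (nth (xs ++ a ∷ b ∷ ys)) σc≡p) (nth-++-∷ xs))
    d↦b : nth i d ≡ b
    d↦b = trans (sym (nth-σ d<ℓ)) (trans (cong (nth (xs ++ a ∷ b ∷ ys)) σd≡1+p) (nth-++-∷-∷ xs))

CommClass-Matching : ∀ {n i j} → InCommClass i j → Matching n i j
CommClass-Matching = go Matching-refl
  where
  go : ∀ {n i j j′} → Matching n i j → Star CommStep j j′ → Matching n i j′
  go m ε = m
  go m (step ◅ steps) = go (Matching-CommStep step m) steps

-- The heap poset

module Heap {n : ℕ} {w i : List ℕ} (red : IsReducedWord n w i) where
  open Prefixes red

  Cover : ℕ → ℕ → Set
  Cover a b = a < b × b < ℓ × ∣ nth i a - nth i b ∣ ≤ 1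

  HeapCover⇒Cover : ∀ {p q} → HeapCover n i p q → ∃ λ a → ∃ λ b → Cover a b × p ≡ x a × q ≡ x b
  HeapCover⇒Cover (a , b , c , d , a<b , i!a≡c , i!b≡d , close , Xa , Xb) =
    a , b , (a<b , b<ℓ , subst₂ (λ c d → ∣ c - d ∣ ≤ 1) (letter a<ℓ i!a≡c) (letter b<ℓ i!b≡d) close) ,
    proj₂ (IsX⇒x Xa) , proj₂ (IsX⇒x Xb)
    where
    a<ℓ = proj₁ (IsX⇒x Xa)
    b<ℓ = proj₁ (IsX⇒x Xb)
    letter : ∀ {k c} → k < ℓ → i ! k ≡ just c → c ≡ nth i k
    letter k<ℓ i!k≡c = just-injective (trans (sym i!k≡c) (!-nth i k<ℓ))

  Cover⇒HeapCover : ∀ {a b} → Cover a b → HeapCover n i (x a) (x b)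
  Cover⇒HeapCover {a} {b} (a<b , b<ℓ , close) =
    a , b , nth i a , nth i b , a<b , !-nth i (<-trans a<b b<ℓ) , !-nth i b<ℓ , close , x-IsX (<-trans a<b b<ℓ) , x-IsX b<ℓ

  HeapLe⇒Star-Cover : ∀ {p q} → HeapLe n i p q → ∀ {a b} → a < ℓ → b < ℓ → p ≡ x a → q ≡ x b → Star Cover a b
  HeapLe⇒Star-Cover ε a<ℓ b<ℓ p≡xa p≡xb = subst (Star Cover _) (x-injective a<ℓ b<ℓ (trans (sym p≡xa) p≡xb)) ε
  HeapLe⇒Star-Cover {p} {q} (c ◅ le) {a} {b} a<ℓ b<ℓ p≡xa q≡xb = step (HeapCover⇒Cover c) le
    where
    step : ∀ {z} → (∃ λ a′ → ∃ λ b′ → Cover a′ b′ × p ≡ x a′ × z ≡ x b′) → HeapLe n i z q → Star Cover a b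
    step (a′ , b′ , cov@(a′<b′ , b′<ℓ , _) , p≡xa′ , z≡xb′) le′ =
      subst (λ a → Star Cover a b) (x-injective (<-trans a′<b′ b′<ℓ) a<ℓ (trans (sym p≡xa′) p≡xa))
        (cov ◅ HeapLe⇒Star-Cover le′ b′<ℓ b<ℓ z≡xb′ q≡xb)

  Star-Cover⇒HeapLe : ∀ {a b} → Star Cover a b → HeapLe n i (x a) (x b)
  Star-Cover⇒HeapLe = gmap x Cover⇒HeapCover

  HeapLe-source : ∀ {p q} → HeapLe n i p q → p ≡ q ⊎ ∃ λ a → a < ℓ × p ≡ x a
  HeapLe-source ε = inj₁ refl
  HeapLe-source (c ◅ _) = inj₂ (source (HeapCover⇒Cover c))
    where
    source : ∀ {p z} → (∃ λ a → ∃ λ b → Cover a b × p ≡ x a × z ≡ x b) → ∃ λ a → a < ℓ × p ≡ x a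
    source (a , _ , (a<b , b<ℓ , _) , p≡xa , _) = a , <-trans a<b b<ℓ , p≡xa

  HeapLe-target : ∀ {p q} → HeapLe n i p q → p ≡ q ⊎ ∃ λ b → b < ℓ × q ≡ x b
  HeapLe-target ε = inj₁ refl
  HeapLe-target (c ◅ le) = inj₂ (target (HeapCover⇒Cover c) (HeapLe-target le))
    where
    target : ∀ {p z q} → (∃ λ a → ∃ λ b → Cover a b × p ≡ x a × z ≡ x b) → z ≡ q ⊎ (∃ λ b → b < ℓ × q ≡ x b) →
             ∃ λ b → b < ℓ × q ≡ x b
    target (_ , b , (_ , b<ℓ , _) , _ , z≡xb) (inj₁ z≡q) = b , b<ℓ , trans (sym z≡q) z≡xb
    target _ (inj₂ found) = found

  Cover? : ∀ a b → Dec (Cover a b)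
  Cover? a b = (a <? b) ×-dec (b <? ℓ) ×-dec (∣ nth i a - nth i b ∣ ≤? 1)

  -- Deciding the reversed closure lets the recursion go down along b.
  Star-Cover? : ∀ a b → Dec (Star Cover a b)
  Star-Cover? a b = map′ (reverse (λ c → c)) (reverse (λ c → c)) (below? b a)
    where
    below? : ∀ b a → Dec (Star (flip Cover) b a)
    below? = <-rec _ λ b below<? a →
      let step? : ∀ c → Dec (Cover c b × Star (flip Cover) c a)
          step? c = dec-step (Cover? c b) (λ cov → below<? (proj₁ cov) a)
      in map′ (λ { (inj₁ refl) → ε ; (inj₂ (_ , _ , cov , st)) → cov ◅ st })
              (λ { ε → inj₁ refl ; (cov ◅ st) → inj₂ (_ , proj₁ cov , cov , st) })
              ((b ≟ a) ⊎-dec anyUpTo? step? b)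
      where
      dec-step : ∀ {A B : Set} → Dec A → (A → Dec B) → Dec (A × B)
      dec-step (yes a) B? = map′ (a ,_) proj₂ (B? a)
      dec-step (no ¬a) _  = no (¬a ∘ proj₁)

  HeapLe? : ∀ p q → Dec (HeapLe n i p q)
  HeapLe? p q with p ≟ₚ q
  ... | yes p≡q = yes (subst (HeapLe n i p) p≡q ε)
  ... | no p≢q with anyUpTo? (λ a → p ≟ₚ x a) ℓ | anyUpTo? (λ b → q ≟ₚ x b) ℓ
  ...   | yes (a , a<ℓ , p≡xa) | yes (b , b<ℓ , q≡xb) =
    map′ (subst₂ (HeapLe n i) (sym p≡xa) (sym q≡xb) ∘ Star-Cover⇒HeapLe) (λ le → HeapLe⇒Star-Cover le a<ℓ b<ℓ p≡xa q≡xb)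
         (Star-Cover? a b)
  ...   | no ¬source | _ = no λ le → [ p≢q , ¬source ] (HeapLe-source le)
  ...   | yes _ | no ¬target = no λ le → [ p≢q , ¬target ] (HeapLe-target le)

  module _ {j} (cc : InCommClass i j) where
    private
      module J = Prefixes (CommClass-reduced cc red)
      open Matching (CommClass-Matching {n} cc)
      <ℓ⇒<∣j∣ : ∀ {k} → k < ℓ → k < J.ℓ
      <ℓ⇒<∣j∣ {k} = subst (k <_) (sym length≡)

    CommClass-length : length j ≡ ℓ
    CommClass-length = length≡

    σ-onto : ∀ {k} → k < ℓ → ∃ λ a → a < ℓ × σ a ≡ k
    σ-onto k<ℓ with Inv-w⁻ (J.Inv-w⁺ (<ℓ⇒<∣j∣ k<ℓ))
    ... | a , a<ℓ , xk≡xa = a , a<ℓ , J.x-injective (<ℓ⇒<∣j∣ (σ-< a<ℓ)) (<ℓ⇒<∣j∣ k<ℓ) (trans (x-σ a<ℓ) (sym xk≡xa))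

    nth-σ≡ : ∀ {c d} → c < ℓ → σ c ≡ d → nth i c ≡ nth j d
    nth-σ≡ c<ℓ σc≡d = trans (sym (nth-σ c<ℓ)) (cong (nth j) σc≡d)

    x-σ≡ : ∀ {c d} → c < ℓ → σ c ≡ d → x c ≡ J.x d
    x-σ≡ c<ℓ σc≡d = trans (sym (x-σ c<ℓ)) (cong J.x σc≡d)

    adjacent-HeapLe : ∀ {k} → suc k < ℓ → ∣ nth j k - nth j (suc k) ∣ ≤ 1 → HeapLe n i (J.x k) (J.x (suc k))
    adjacent-HeapLe {k} 1+k<ℓ close = compare (σ-onto (<-trans (n<1+n k) 1+k<ℓ)) (σ-onto 1+k<ℓ)
      where
      compare : (∃ λ a → a < ℓ × σ a ≡ k) → (∃ λ b → b < ℓ × σ b ≡ suc k) → HeapLe n i (J.x k) (J.x (suc k))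
      compare (a , a<ℓ , σa≡k) (b , b<ℓ , σb≡1+k) with <-cmp a b
      ... | tri< a<b _ _ = subst₂ (HeapLe n i) (x-σ≡ a<ℓ σa≡k) (x-σ≡ b<ℓ σb≡1+k) (Cover⇒HeapCover (a<b , b<ℓ , close-ab) ◅ ε)
        where
        close-ab : ∣ nth i a - nth i b ∣ ≤ 1
        close-ab = subst (_≤ 1) (sym (cong₂ ∣_-_∣ (nth-σ≡ a<ℓ σa≡k) (nth-σ≡ b<ℓ σb≡1+k))) close
      ... | tri≈ _ a≡b _ = contradiction (trans (sym σb≡1+k) (trans (cong σ (sym a≡b)) σa≡k)) 1+n≢n
      ... | tri> _ _ b<a = contradiction (subst₂ _<_ σb≡1+k σa≡k (σ-mono b<a a<ℓ close-ba)) (<-asym (n<1+n k))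
        where
        close-ba : ∣ nth i b - nth i a ∣ ≤ 1
        close-ba = subst (_≤ 1) (trans (∣-∣-comm (nth j k) (nth j (suc k))) (sym (cong₂ ∣_-_∣ (nth-σ≡ b<ℓ σb≡1+k) (nth-σ≡ a<ℓ σa≡k))))
                         close

    Inv-prefix-downward : ∀ {m} → m ≤ ℓ → ∀ {p q} → InInv (J.prefix m) q → HeapLe n i p q → InInv (J.prefix m) p
    Inv-prefix-downward m≤ℓ inv ε = inv
    Inv-prefix-downward {m} m≤ℓ {p} inv (c ◅ le) = lower (HeapCover⇒Cover c) (Inv-prefix-downward m≤ℓ inv le)
      where
      m≤∣j∣ = subst (m ≤_) (sym length≡) m≤ℓ
      lower : ∀ {z} → (∃ λ a → ∃ λ b → Cover a b × p ≡ x a × z ≡ x b) → InInv (J.prefix m) z → InInv (J.prefix m) p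
      lower (a , b , (a<b , b<ℓ , close) , p≡xa , z≡xb) inv-z =
        let k , k<m , z≡xk = J.Inv-prefix⁻ m≤∣j∣ inv-z
            σb≡k = J.x-injective (<ℓ⇒<∣j∣ (σ-< b<ℓ)) (<-≤-trans k<m m≤∣j∣) (trans (x-σ b<ℓ) (trans (sym z≡xb) z≡xk))
            σa<m = <-trans (σ-mono a<b b<ℓ close) (subst (_< m) (sym σb≡k) k<m)
        in subst (InInv (J.prefix m)) (trans (x-σ (<-trans a<b b<ℓ)) (sym p≡xa)) (J.Inv-prefix⁺ m≤∣j∣ σa<m)

-- Realising an order ideal by bubbling

trues : List Bool → ℕ
trues [] = 0
trues (true ∷ bs)  = suc (trues bs)
trues (false ∷ bs) = trues bs

-- the sum of the positions of the entries true
weight : List Bool → ℕ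
weight [] = 0
weight (_ ∷ bs) = trues bs + weight bs

weight-bubble : ∀ bs R → trues (bs ++ true ∷ false ∷ R) ≡ trues (bs ++ false ∷ true ∷ R) ×
                         weight (bs ++ true ∷ false ∷ R) < weight (bs ++ false ∷ true ∷ R)
weight-bubble [] R = refl , n<1+n _
weight-bubble (b ∷ bs) R with weight-bubble bs R
... | trues≡ , weight< = trues-∷ b trues≡ , +-mono-≤-< (≤-reflexive trues≡) weight<
  where
  trues-∷ : ∀ b {bs bs′} → trues bs ≡ trues bs′ → trues (b ∷ bs) ≡ trues (b ∷ bs′)
  trues-∷ true  = cong suc
  trues-∷ false = λ eq → eq

downward-initial-segment : ∀ {P : ℕ → Set} → (∀ k → Dec (P k)) → ∀ L → (∀ {k} → suc k < L → P (suc k) → P k) →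
  ∃ λ m → m ≤ L × (∀ {k} → k < L → P k → k < m) × (∀ {k} → k < m → P k)
downward-initial-segment P? zero _ = 0 , z≤n , (λ ()) , (λ ())
downward-initial-segment {P} P? (suc L) down with P? L
... | yes PL = suc L , ≤-refl , (λ k<1+L _ → k<1+L) , all-below
  where
  down* : ∀ d {k} → d + k ≤ L → P (d + k) → P k
  down* zero    _       Pk   = Pk
  down* (suc d) 1+d+k≤L P1+d+k = down* d (<⇒≤ 1+d+k≤L) (down (s≤s 1+d+k≤L) P1+d+k)
  all-below : ∀ {k} → k < suc L → P k
  all-below {k} k<1+L = let L∸k+k≡L = m∸n+n≡m (≤-pred k<1+L) in
    down* (L ∸ k) (≤-reflexive L∸k+k≡L) (subst P (sym L∸k+k≡L) PL)
... | no ¬PL with downward-initial-segment P? L (λ 1+k<L → down (m<n⇒m<1+n 1+k<L))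
...   | m , m≤L , P⇒<m , <m⇒P = m , m≤n⇒m≤1+n m≤L , bounded , <m⇒P
  where
  bounded : ∀ {k} → k < suc L → P k → k < m
  bounded k<1+L Pk = [ (λ k<L → P⇒<m k<L Pk) , (λ { refl → contradiction Pk ¬PL }) ] (m<1+n⇒m<n∨m≡n k<1+L)

pairAt-nth : ∀ (j : List ℕ) {k} → suc k < length j → pairAt (suc k) j ≡ (nth j k , nth j (suc k))
pairAt-nth (a ∷ b ∷ j) {zero}  _ = refl
pairAt-nth (a ∷ j)     {suc k} (s≤s 1+k<∣j∣) = pairAt-nth j 1+k<∣j∣

module _ (I : List Pair) where
  open import Data.List.Membership.DecPropositional _≟ₚ_ using (_∈?_)

  marks : List ℕ → List ℕ → List Bool
  marks u []      = []
  marks u (a ∷ j) = does (pairAt a u ∈? I) ∷ marks (swapAt a u) j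

  marks-bubble : ∀ u j {k} → suc k < length j → 2 ≤ ∣ nth j k - nth j (suc k) ∣ →
    x-from u j k ∉ I → x-from u j (suc k) ∈ I →
    ∃ λ bs → ∃ λ R → marks u j ≡ bs ++ false ∷ true ∷ R × marks u (swapAt (suc k) j) ≡ bs ++ true ∷ false ∷ R
  marks-bubble u (a ∷ b ∷ ys) {zero} _ far ∉I ∈I = [] , R , before , after
    where
    R = marks (swapAt b (swapAt a u)) ys
    before : marks u (a ∷ b ∷ ys) ≡ false ∷ true ∷ R
    before = cong₂ (λ c d → c ∷ d ∷ R) (dec-false (pairAt a u ∈? I) ∉I) (dec-true (pairAt b (swapAt a u) ∈? I) ∈I)
    after : marks u (b ∷ a ∷ ys) ≡ true ∷ false ∷ R
    after = cong₂ _∷_ (dec-true (pairAt b u ∈? I) (subst (_∈ I) (pairAt-swapAt a b u far) ∈I))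
              (cong₂ _∷_ (dec-false (pairAt a (swapAt b u) ∈? I) (∉I ∘ subst (_∈ I) (pairAt-swapAt b a u far′)))
                         (cong (λ v → marks v ys) (swapAt-comm a b u far)))
      where far′ = subst (2 ≤_) (∣-∣-comm a b) far
  marks-bubble u (a ∷ j) {suc k} (s≤s 1+k<∣j∣) far ∉I ∈I with marks-bubble (swapAt a u) j 1+k<∣j∣ far ∉I ∈I
  ... | bs , R , before , after = does (pairAt a u ∈? I) ∷ bs , R , cong (_ ∷_) before , cong (_ ∷_) after

Realises : ℕ → List ℕ → List ℕ → List Pair → Set
Realises n i u I = InPre n i u × (∀ p → InInv u p ⇔ p ∈ I)

module Realisation {n : ℕ} {w i : List ℕ} (red : IsReducedWord n w i) {I : List Pair}
  (I⊆Inv : ∀ {p} → p ∈ I → InInv w p)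
  (I-closed : ∀ {p q} → q ∈ I → InInv w p → HeapLe n i p q → p ∈ I) where
  open Prefixes red
  open Heap red
  open import Data.List.Membership.DecPropositional _≟ₚ_ using (_∈?_)

  NoDescent : List ℕ → Set
  NoDescent j = ∀ {k} → suc k < ℓ → addedInversion n j (suc k) ∈ I → addedInversion n j k ∈ I

  Descent : List ℕ → ℕ → Set
  Descent j k = suc k < ℓ × addedInversion n j k ∉ I × addedInversion n j (suc k) ∈ I

  -- As I is a down-set, the two letters at a descent are incomparable in P_C, hence commute.
  descent-far : ∀ {j k} → InCommClass i j → Descent j k → 2 ≤ ∣ nth j k - nth j (suc k) ∣
  descent-far {j} {k} cc (1+k<ℓ , ∉I , ∈I) with ∣ nth j k - nth j (suc k) ∣ ≤? 1
  ... | no  ¬close = ≰⇒> ¬close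
  ... | yes close  = contradiction (I-closed ∈I (J.Inv-w⁺ k<∣j∣) (adjacent-HeapLe cc 1+k<ℓ close)) ∉I
    where
    module J = Prefixes (CommClass-reduced cc red)
    k<∣j∣ = subst (k <_) (sym (CommClass-length cc)) (<-trans (n<1+n k) 1+k<ℓ)

  Descent? : ∀ j k → Dec (Descent j k)
  Descent? j k = (suc k <? ℓ) ×-dec ¬? (addedInversion n j k ∈? I) ×-dec (addedInversion n j (suc k) ∈? I)

  potential : List ℕ → ℕ
  potential j = weight (marks I (idPerm n) j)

  bubble : ∀ j → InCommClass i j → Acc _<_ (potential j) → ∃ λ j′ → InCommClass i j′ × NoDescent j′
  bubble j cc (acc smaller) with anyUpTo? (Descent? j) ℓ
  ... | no none = j , cc , λ {k} 1+k<ℓ ∈I →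
    decidable-stable (addedInversion n j k ∈? I) λ ∉I → none (k , <-trans (n<1+n k) 1+k<ℓ , 1+k<ℓ , ∉I , ∈I)
  ... | yes (k , _ , descent@(1+k<ℓ , ∉I , ∈I)) = bubble (swapAt (suc k) j) (cc ◅◅ step ◅ ε) (smaller decreased)
    where
    far = descent-far cc descent
    1+k<∣j∣ = subst (suc k <_) (sym (CommClass-length cc)) 1+k<ℓ
    step : CommStep j (swapAt (suc k) j)
    step with swapAt-split (suc k) j (s≤s z≤n) 1+k<∣j∣
    ... | A , c , d , B , j≡ , swapped , pair = subst₂ CommStep (sym j≡) (sym swapped) (comm A B c d far′)
      where
      far′ : 2 ≤ ∣ c - d ∣
      far′ = subst (2 ≤_) (cong (uncurry ∣_-_∣) (trans (sym (pairAt-nth j 1+k<∣j∣)) pair)) far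
    decreased : potential (swapAt (suc k) j) < potential j
    decreased with marks-bubble I (idPerm n) j 1+k<∣j∣ far ∉I ∈I
    ... | bs , R , before , after = subst₂ _<_ (cong weight (sym after)) (cong weight (sym before)) (proj₂ (weight-bubble bs R))

  realise : ∃ λ u → Realises n i u I
  realise with bubble i ε (<-wellFounded _)
  ... | j , cc , no-descent with downward-initial-segment (λ k → addedInversion n j k ∈? I) ℓ no-descent
  ...   | m , m≤ℓ , ∈I⇒<m , <m⇒∈I = J.prefix m , (j , cc , m , m≤ℓ , refl) , λ p → mk⇔ to from
    where
    module J = Prefixes (CommClass-reduced cc red)
    m≤∣j∣ = subst (m ≤_) (sym (CommClass-length cc)) m≤ℓ
    to : ∀ {p} → InInv (J.prefix m) p → p ∈ I
    to inv = let k , k<m , p≡xk = J.Inv-prefix⁻ m≤∣j∣ inv in subst (_∈ I) (sym p≡xk) (<m⇒∈I k<m)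
    from : ∀ {p} → p ∈ I → InInv (J.prefix m) p
    from p∈I = let k , k<∣j∣ , p≡xk = J.Inv-w⁻ (I⊆Inv p∈I)
                   k<ℓ = subst (k <_) (CommClass-length cc) k<∣j∣
               in subst (InInv (J.prefix m)) (sym p≡xk) (J.Inv-prefix⁺ m≤∣j∣ (∈I⇒<m k<ℓ (subst (_∈ I) p≡xk p∈I)))

-- Counting order ideals

module Counting {n : ℕ} {w i : List ℕ} (red : IsReducedWord n w i) where
  open Prefixes red
  open Heap red
  open import Data.List.Membership.DecPropositional _≟ₚ_ using (_∈?_)

  Ideal : List Pair → Set
  Ideal = IsIdeal (InInv w) (HeapLe n i)

  Ideal-sorted : ∀ {I} → Ideal I → Sorted I
  Ideal-sorted (linked , _) = Linked⇒AllPairs <ₗ-trans linked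

  Ideal-≡ : ∀ {I I′} → Ideal I → Ideal I′ → (∀ {p} → p ∈ I → p ∈ I′) → (∀ {p} → p ∈ I′ → p ∈ I) → I ≡ I′
  Ideal-≡ idl idl′ = Sorted-⊆-antisym (Ideal-sorted idl) (Ideal-sorted idl′)

  InPre-↭ : ∀ {u} → InPre n i u → u ↭ idPerm n
  InPre-↭ (j , _ , m , _ , refl) = applySwaps-↭ (idPerm n) (take m j)

  InPre-Inv⊆Inv-w : ∀ {u p} → InPre n i u → InInv u p → InInv w p
  InPre-Inv⊆Inv-w (j , cc , m , m≤ℓ , refl) =
    Prefixes.Inv-prefix⊆Inv-w (CommClass-reduced cc red) (subst (m ≤_) (sym (CommClass-length cc)) m≤ℓ)

  InPre-downward : ∀ {u p q} → InPre n i u → InInv u q → HeapLe n i p q → InInv u p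
  InPre-downward (j , cc , m , m≤ℓ , refl) = Inv-prefix-downward cc m≤ℓ

  invs : List Pair
  invs = sort (applyUpTo x ℓ)

  invs-sorted : Sorted invs
  invs-sorted = sort-sorted (applyUpTo x ℓ)

  ∈-invs⁻ : ∀ {p} → p ∈ invs → InInv w p
  ∈-invs⁻ p∈ with ∈-applyUpTo⁻ x (∈-sort⁻ (applyUpTo x ℓ) p∈)
  ... | k , k<ℓ , refl = Inv-w⁺ k<ℓ

  ∈-invs⁺ : ∀ {p} → InInv w p → p ∈ invs
  ∈-invs⁺ inv with Inv-w⁻ inv
  ... | k , k<ℓ , refl = ∈-sort⁺ (applyUpTo x ℓ) (∈-applyUpTo⁺ x k<ℓ)

  Closed : List Pair → Set
  Closed I = All (λ p → All (λ q → HeapLe n i p q → p ∈ I) I) invs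

  Closed? : ∀ I → Dec (Closed I)
  Closed? I = All.all? (λ p → All.all? (λ q → HeapLe? p q →-dec p ∈? I) I) invs

  ideals : List (List Pair)
  ideals = filter Closed? (sublists invs)

  ideals-unique : Unique ideals
  ideals-unique = UniqueP.filter⁺ Closed? (sublists-unique (Sorted⇒Unique invs-sorted))

  ∈-ideals⁻ : ∀ {I} → I ∈ ideals → Ideal I
  ∈-ideals⁻ I∈ with ∈-filter⁻ Closed? I∈
  ... | I∈sub , closed =
    AllPairs⇒Linked (sublists-AllPairs invs-sorted I∈sub) , (λ p p∈ → ∈-invs⁻ (∈-sublists⇒⊆ invs I∈sub p∈)) ,
    λ p q q∈ inv le → All.lookup (All.lookup closed (∈-invs⁺ inv)) q∈ le

  ∈-ideals⁺ : ∀ {I} → Ideal I → I ∈ ideals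
  ∈-ideals⁺ idl@(_ , I⊆Inv , closed) =
    ∈-filter⁺ Closed? (∈-sublists⁺ invs-sorted (Ideal-sorted idl) (λ {p} p∈ → ∈-invs⁺ (I⊆Inv p p∈)))
      (All.tabulate λ {p} p∈ → All.tabulate λ {q} q∈ le → closed p q q∈ (∈-invs⁻ p∈) le)

  realise : ∀ {I} → Ideal I → ∃ λ u → Realises n i u I
  realise (_ , I⊆Inv , closed) = Realisation.realise red (I⊆Inv _) (closed _ _)

  Realises-functional : ∀ {I u u′} → Realises n i u I → Realises n i u′ I → u ≡ u′
  Realises-functional (pre , inv⇔) (pre′ , inv⇔′) =
    Inv-injective (Unique-resp-↭ (↭-sym (InPre-↭ pre)) (idPerm-unique n)) (↭-trans (InPre-↭ pre) (↭-sym (InPre-↭ pre′)))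
      λ p → mk⇔ (Equivalence.from (inv⇔′ p) ∘ Equivalence.to (inv⇔ p)) (Equivalence.from (inv⇔ p) ∘ Equivalence.to (inv⇔′ p))

  Realises-injective : ∀ {I I′ u} → Ideal I → Ideal I′ → Realises n i u I → Realises n i u I′ → I ≡ I′
  Realises-injective idl idl′ (_ , inv⇔) (_ , inv⇔′) =
    Ideal-≡ idl idl′ (λ {p} → Equivalence.to (inv⇔′ p) ∘ Equivalence.from (inv⇔ p))
                     (λ {p} → Equivalence.to (inv⇔ p) ∘ Equivalence.from (inv⇔′ p))

  InPre-realises : ∀ {u} → InPre n i u → ∃ λ I → Ideal I × Realises n i u I
  InPre-realises {u} pre = I , idl , pre , λ p → mk⇔ ∈I⁺ (proj₂ ∘ ∈-filter⁻ (InInv? u) {xs = invs})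
    where
    I = filter (InInv? u) invs
    ∈I⁺ : ∀ {p} → InInv u p → p ∈ I
    ∈I⁺ inv = ∈-filter⁺ (InInv? u) (∈-invs⁺ (InPre-Inv⊆Inv-w pre inv)) inv
    idl : Ideal I
    idl = AllPairs⇒Linked (AllPairsP.filter⁺ (InInv? u) invs-sorted) ,
          (λ p p∈ → ∈-invs⁻ (proj₁ (∈-filter⁻ (InInv? u) {xs = invs} p∈))) ,
          λ p q q∈ _ le → ∈I⁺ (InPre-downward pre (proj₂ (∈-filter⁻ (InInv? u) {xs = invs} q∈)) le)

  module _ {ab : Pair} (ab∈Inv : InInv w ab) where

    Containing : List Pair → Set
    Containing I = Ideal I × ab ∈ I

    containing-size : HasSize Containing (length (filter (ab ∈?_) ideals))
    containing-size =
      filter (ab ∈?_) ideals , UniqueP.filter⁺ (ab ∈?_) ideals-unique ,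
      (λ I → mk⇔ (λ I∈ → let I∈ideals , ab∈I = ∈-filter⁻ (ab ∈?_) I∈ in ∈-ideals⁻ I∈ideals , ab∈I)
                 (λ (idl , ab∈I) → ∈-filter⁺ (ab ∈?_) (∈-ideals⁺ idl) ab∈I)) ,
      refl

    prefix-size : ∀ {k} → HasSize Containing k → HasSize (λ u → InPre n i u × InInv u ab) k
    prefix-size size = HasSize-bijection size (λ I u → Realises n i u I)
      (realise ∘ proj₁)
      (λ _ → Realises-functional)
      (λ (idl , _) (idl′ , _) → Realises-injective idl idl′)
      (λ (_ , ab∈I) (pre , inv⇔) → pre , Equivalence.from (inv⇔ ab) ab∈I)
      (λ (pre , ab∈u) → let I , idl , real = InPre-realises pre in I , (idl , Equivalence.to (proj₂ real ab) ab∈u) , real)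

    Outside : Pair → Set
    Outside p = InInv w p × ¬ HeapLe n i p ab

    cut : List Pair → List Pair
    cut = filter (λ p → ¬? (HeapLe? p ab))

    ∈-cut⁻ : ∀ I {p} → p ∈ cut I → p ∈ I × ¬ HeapLe n i p ab
    ∈-cut⁻ I = ∈-filter⁻ (λ p → ¬? (HeapLe? p ab)) {xs = I}

    ∈-cut⁺ : ∀ {I p} → p ∈ I → ¬ HeapLe n i p ab → p ∈ cut I
    ∈-cut⁺ = ∈-filter⁺ (λ p → ¬? (HeapLe? p ab))

    cut-reflects-⊆ : ∀ {I I′} → Ideal I → Containing I′ → cut I ⊆ cut I′ → I ⊆ I′
    cut-reflects-⊆ {I} {I′} (_ , I⊆Inv , _) ((_ , _ , closed′) , ab∈I′) cut⊆ {p} p∈I with HeapLe? p ab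
    ... | yes p≤ab = closed′ p ab ab∈I′ (I⊆Inv p p∈I) p≤ab
    ... | no  p≰ab = proj₁ (∈-cut⁻ I′ (cut⊆ (∈-cut⁺ p∈I p≰ab)))

    cut-injective : ∀ {I I′} → Containing I → Containing I′ → cut I ≡ cut I′ → I ≡ I′
    cut-injective c@(idl , _) c′@(idl′ , _) same =
      Ideal-≡ idl idl′ (cut-reflects-⊆ idl c′ (subst (_ ⊆_) same (λ p∈ → p∈)))
                       (cut-reflects-⊆ idl′ c (subst (_ ⊆_) (sym same) (λ p∈ → p∈)))

    cut-Ideal : ∀ {I} → Ideal I → IsIdeal Outside (HeapLe n i) (cut I)
    cut-Ideal {I} (linked , I⊆Inv , closed) =
      AllPairs⇒Linked (AllPairsP.filter⁺ (λ p → ¬? (HeapLe? p ab)) (Linked⇒AllPairs <ₗ-trans linked)) ,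
      (λ p p∈ → let p∈I , p≰ab = ∈-cut⁻ I p∈ in I⊆Inv p p∈I , p≰ab) ,
      λ p q q∈ (inv , p≰ab) le → ∈-cut⁺ (closed p q (proj₁ (∈-cut⁻ I q∈)) inv le) p≰ab

    -- the inverse of cut adds the down-set of ab back
    cut-onto : ∀ {J} → IsIdeal Outside (HeapLe n i) J → ∃ λ I → Containing I × cut I ≡ J
    cut-onto {J} (linkedJ , J⊆Outside , closedJ) = I , (idl , ∈I⁺ ab∈Inv (inj₂ ε)) , Sorted-⊆-antisym sorted-cut sortedJ cut⊆J J⊆cut
      where
      InJ-or-≤ab? : ∀ p → Dec (p ∈ J ⊎ HeapLe n i p ab)
      InJ-or-≤ab? p = (p ∈? J) ⊎-dec HeapLe? p ab
      I = filter InJ-or-≤ab? invs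
      ∈I⁺ : ∀ {p} → InInv w p → p ∈ J ⊎ HeapLe n i p ab → p ∈ I
      ∈I⁺ inv = ∈-filter⁺ InJ-or-≤ab? (∈-invs⁺ inv)
      sortedI = AllPairsP.filter⁺ InJ-or-≤ab? invs-sorted
      sortedJ = Linked⇒AllPairs <ₗ-trans linkedJ
      sorted-cut = AllPairsP.filter⁺ (λ p → ¬? (HeapLe? p ab)) sortedI
      closed : ∀ p q → q ∈ I → InInv w p → HeapLe n i p q → p ∈ I
      closed p q q∈ inv p≤q with proj₂ (∈-filter⁻ InJ-or-≤ab? {xs = invs} q∈) | HeapLe? p ab
      ... | _         | yes p≤ab = ∈I⁺ inv (inj₂ p≤ab)
      ... | inj₁ q∈J  | no p≰ab  = ∈I⁺ inv (inj₁ (closedJ p q q∈J (inv , p≰ab) p≤q))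
      ... | inj₂ q≤ab | no p≰ab  = contradiction (p≤q ◅◅ q≤ab) p≰ab
      idl : Ideal I
      idl = AllPairs⇒Linked sortedI , (λ p p∈ → ∈-invs⁻ (proj₁ (∈-filter⁻ InJ-or-≤ab? {xs = invs} p∈))) , closed
      cut⊆J : cut I ⊆ J
      cut⊆J p∈ with ∈-cut⁻ I p∈
      ... | p∈I , p≰ab with proj₂ (∈-filter⁻ InJ-or-≤ab? {xs = invs} p∈I)
      ...   | inj₁ p∈J  = p∈J
      ...   | inj₂ p≤ab = contradiction p≤ab p≰ab
      J⊆cut : J ⊆ cut I
      J⊆cut {p} p∈J = ∈-cut⁺ (∈I⁺ (proj₁ (J⊆Outside p p∈J)) (inj₁ p∈J)) (proj₂ (J⊆Outside p p∈J))

    complement-size : ∀ {k} → HasSize Containing k → HasSize (IsIdeal Outside (HeapLe n i)) k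
    complement-size size = HasSize-bijection size (λ I J → cut I ≡ J)
      (λ _ → _ , refl)
      (λ _ e e′ → trans (sym e) e′)
      (λ c c′ e e′ → cut-injective c c′ (trans e (sym e′)))
      (λ { (idl , _) refl → cut-Ideal idl })
      cut-onto

proposition2p5 : ∀ (n : ℕ) (w : List ℕ) → IsPerm n w →
    ∀ (i : List ℕ) → IsReducedWord n w i →
    ∀ (ρ : List ℕ → ℕ) → IsIndicator ρ (InPre n i) →
    ∀ (a b : ℕ) → InInv w (a , b) →
    Σ ℕ λ k →
      TallyIs (λ u → InPre n i u × InInv u (a , b)) ρ k ×
      HasSize (λ I → IsIdeal (InInv w) (HeapLe n i) I × ((a , b) ∈ I)) k ×
      HasSize (IsIdeal (λ x → InInv w x × ¬ HeapLe n i x (a , b)) (HeapLe n i)) k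
proposition2p5 n w _ i red ρ ρ-indicator a b ab∈Inv =
  _ , TallyIs-indicator ρ-indicator proj₁ (prefix-size ab∈Inv containing) , containing , complement-size ab∈Inv containing
  where
  open Counting red
  containing = containing-size ab∈Inv
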